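{- Let $t,\lambda$ be positive integers with $t\ge 2$, and let $D$ be a $(t,\lambda)$-liking digraph. Then the following are equivalent: (a) $D$ is isomorphic to $\overleftrightarrow{K}_{t+\lambda}$; (b) $D$ is a $(t-1,\lambda+1)$-liking digraph; (c) $d^+(v)=t+\lambda-1$ for each vertex $v$ of $D$. Furthermore, if $(t,\lambda)\neq(2,1)$, then (a) is equivalent to (d) there is a vertex $v$ with $N^+(v)=V(D)\setminus\{v\}$; and if $t\ge 3$, then (a) is equivalent to (e) $D$ is diregular.
   Context: All digraphs are finite and have no loops and no multiple arcs. For positive integers $t,\lambda$, a digraph $D$ is a $(t,\lambda)$-liking digraph if every set of $t$ distinct vertices of $D$ has exactly $\lambda$ common out-neighbors (the definition presumes $D$ has at least $t$ vertices). $N^+(v)$ is the out-neighborhood of $v$, $d^+(v)$ its out-degree and $d^-(v)$ its in-degree. A digraph is $k$-diregular if every vertex has out-degree $k$ and in-degree $k$, and diregular if it is $k$-diregular for some positive integer $k$. $\overleftrightarrow{K}_n$ denotes the complete digraph on $n$ vertices (both arcs between every pair of distinct vertices). -}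

module Defs where

open import Data.Nat using (ℕ; _≤_; _<_; _+_; _∸_; suc)
open import Data.Bool using (Bool; true; false; not)
open import Data.Fin using (Fin)
open import Data.Fin.Properties using (_≟_)
open import Data.Fin.Subset using (Subset; ∣_∣; ∁; ⁅_⁆; _∈_)
open import Data.Vec using (tabulate)
open import Data.Fin.Subset.Properties using (_⊆?_)
open import Data.Product using (Σ; _×_)
open import Function.Bundles using (_↔_; Inverse)
open import Relation.Nullary.Decidable using (⌊_⌋)
open import Relation.Binary.PropositionalEquality using (_≡_)

record Digraph : Set where
  field
    size  : ℕ
    arc   : Fin size → Fin size → Bool
    loopless : ∀ v → arc v v ≡ false
open Digraph public

outNbr : (D : Digraph) → Fin (size D) → Subset (size D)
outNbr D v = tabulate (arc D v)

inNbr : (D : Digraph) → Fin (size D) → Subset (size D)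
inNbr D v = tabulate (λ u → arc D u v)

outdeg indeg : (D : Digraph) → Fin (size D) → ℕ
outdeg D v = ∣ outNbr D v ∣
indeg D v = ∣ inNbr D v ∣

commonOut : (D : Digraph) → Subset (size D) → Subset (size D)
commonOut D S = tabulate (λ w → ⌊ S ⊆? inNbr D w ⌋)

Liking : ℕ → ℕ → Digraph → Set
Liking t l D = (t ≤ size D) × (∀ (S : Subset (size D)) → ∣ S ∣ ≡ t → ∣ commonOut D S ∣ ≡ l)

complete : ℕ → Digraph
complete n = record { size = n ; arc = λ u v → not ⌊ u ≟ v ⌋ ; loopless = lem }
  where
  open import Relation.Nullary using (yes; no)
  open import Relation.Binary.PropositionalEquality using (refl)
  lem : ∀ v → not ⌊ v ≟ v ⌋ ≡ false
  lem v with v ≟ v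
  ... | yes _ = refl
  ... | no ¬p with ¬p refl
  ... | ()

Isomorphic : Digraph → Digraph → Set
Isomorphic D E = Σ (Fin (size D) ↔ Fin (size E)) λ f →
  ∀ u v → arc D u v ≡ arc E (Inverse.to f u) (Inverse.to f v)

Diregular : Digraph → Set
Diregular D = Σ ℕ λ k → (1 ≤ k) × (∀ v → (outdeg D v ≡ k) × (indeg D v ≡ k))

{-# OPTIONS --safe #-}
module Submission where

-- The complete digraph on t + λ vertices is (s, t + λ - s)-liking for every s ≥ 1, which gives
-- (a) ⇒ (b)–(e).  Conversely each of (b)–(e) forces D to be complete, and the liking property then
-- fixes its order at t + λ.
-- (c) With out-degree t + λ - 1, every closed out-neighbourhood is a clique that no arc leaves, and a
--     t-set meeting two of them would have no common out-neighbour.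
-- (b) For t = 2 this is (c).  Otherwise, adding a common out-neighbour to a (t - 1)-set loses exactly
--     one common out-neighbour, so common out-neighbourhoods of (t - 1)-sets are cliques, and an
--     exchange argument makes every (t - 1)-set a clique.  A digraph that is (t, 0)- and
--     (t - 1, 1)-liking (needed for (d)) is complete too: double counting shows that every vertex
--     outside a (t - 1)-set is a common out-neighbour of it.
-- (d) A vertex joined to all others is also joined from all others, and deleting it leaves a digraph
--     that is (t - 1, λ)- and (t, λ - 1)-liking, to which (b) applies unless (t, λ) = (2, 1).
-- (e) If D is k-diregular of order n, double counting shows that D is (s, μₛ)-liking for all s ≤ t,
--     with μₛ (k - s) = (n - s) μₛ₊₁, and a variance argument shows that any two vertices also have
--     μ₂ common in-neighbours.  Counting inside one in-neighbourhood gives a third equation, and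
--     together with μ₁ = k these force n = k + 1.

open import Defs
open import Data.Nat using (ℕ; _≤_; _+_; _∸_)
open import Data.Fin using (Fin)
open import Data.Fin.Subset using (∁; ⁅_⁆)
open import Data.Product using (Σ; _×_)
open import Function.Bundles using (_⇔_)
open import Relation.Nullary using (¬_)
open import Relation.Binary.PropositionalEquality using (_≡_)

open import Data.Bool using (Bool; true; false; _∧_; _∨_; not)
open import Data.Bool.Properties using (¬-not; not-¬)
open import Data.Empty using (⊥; ⊥-elim)
open import Data.Fin using (zero; suc)
open import Data.Fin.Permutation using (↔⇒≡)
open import Data.Fin.Properties using (_≟_; any?)
import Data.Fin.Subset as Subset
open import Data.Fin.Subset.Properties using (_⊆?_)
open import Data.List using (_∷_; [])
open import Data.Nat using (zero; suc; _*_; _<_; z≤n; s≤s; s≤s⁻¹; >-nonZero)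
open import Data.Nat.Properties hiding (_≟_)
open import Data.Nat.Tactic.RingSolver using (solve-∀; solve)
open import Data.Product using (∃-syntax; _,_; proj₁; proj₂)
open import Data.Sum using (_⊎_; inj₁; inj₂; [_,_]′)
open import Data.Vec using (tabulate; lookup)
open import Data.Vec.Properties
  using (lookup∘tabulate; tabulate∘lookup; tabulate-cong; lookup-map; lookup-replicate; []=⇒lookup; lookup⇒[]=)
open import Function using (_∘_)
open import Function.Bundles using (mk⇔; Inverse; Injection; Equivalence)
import Function.Properties.Equivalence as ⇔
open import Function.Properties.Inverse using (↔-refl; ↔⇒↣)
open import Relation.Binary.PropositionalEquality
  using (_≢_; refl; sym; trans; cong; cong₂; subst; module ≡-Reasoning)
open import Relation.Nullary using (Dec; yes; no)
open import Relation.Nullary.Decidable using (⌊_⌋)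
open import Algebra.Properties.Semiring.Sum +-*-semiring
  using (sum; sum-syntax; ∑-comm; ∑-distrib-+; *-distribˡ-sum; *-distribʳ-sum; sum-cong-≗; sum-replicate-zero)

private variable
  m n : ℕ

-- Finite sums and finite sets

sum-mono-≤ : {f g : Fin n → ℕ} → (∀ i → f i ≤ g i) → sum f ≤ sum g
sum-mono-≤ {zero}  f≤g = z≤n
sum-mono-≤ {suc n} f≤g = +-mono-≤ (f≤g zero) (sum-mono-≤ (f≤g ∘ suc))

∑-const : ∀ c → ∑[ i < n ] c ≡ n * c
∑-const {zero}  c = refl
∑-const {suc n} c = cong (c +_) (∑-const {n} c)

∑-zero : {f : Fin n → ℕ} → (∀ i → f i ≡ 0) → ∑[ i < n ] f i ≡ 0
∑-zero {n} f≡0 = trans (sum-cong-≗ f≡0) (sum-replicate-zero n)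

sum-squeeze : {f g : Fin n → ℕ} → (∀ i → f i ≤ g i) → sum g ≤ sum f → ∀ i → f i ≡ g i
sum-squeeze {suc n} {f} {g} f≤g ∑g≤∑f zero = ≤-antisym (f≤g zero)
  (+-cancelʳ-≤ (sum (g ∘ suc)) (g zero) (f zero)
    (≤-trans ∑g≤∑f (+-monoʳ-≤ (f zero) (sum-mono-≤ (f≤g ∘ suc)))))
sum-squeeze {suc n} {f} {g} f≤g ∑g≤∑f (suc i) = sum-squeeze (f≤g ∘ suc)
  (+-cancelˡ-≤ (g zero) _ _ (≤-trans ∑g≤∑f (+-monoˡ-≤ (sum (f ∘ suc)) (f≤g zero)))) i

-- Vertex sets are Boolean predicates rather than `Subset`s, so that sets such as common
-- out-neighbourhoods can be defined pointwise; `∣tabulate∣` relates the two cardinalities.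
BSet : ℕ → Set
BSet n = Fin n → Bool

infix 4 _∈_ _∉_ _⊆_

private variable
  P Q R A : BSet n
  x y : Fin n

-- Membership and the set operations are opaque so that `x ∈ P` determines `x` and `P` in
-- unification problems.
opaque
  _∈_ _∉_ : Fin n → BSet n → Set
  x ∈ P = P x ≡ true
  x ∉ P = P x ≡ false

  ∈-or-∉ : ∀ x (P : BSet n) → x ∈ P ⊎ x ∉ P
  ∈-or-∉ x P with P x
  ... | true  = inj₁ refl
  ... | false = inj₂ refl

  ∉⇒¬∈ : x ∉ P → ¬ x ∈ P
  ∉⇒¬∈ = not-¬

  ¬∈⇒∉ : ¬ x ∈ P → x ∉ P
  ¬∈⇒∉ = ¬-not

_⊆_ : BSet n → BSet n → Set
P ⊆ Q = ∀ x → x ∈ P → x ∈ Q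

∅ full : BSet n
∅    _ = false
full _ = true

infixr 7 _∩_
infixl 6 _∪_
infixl 5 _─_

opaque
  unfolding _∈_

  ｛_｝ : Fin n → BSet n
  ｛ zero  ｝ zero    = true
  ｛ zero  ｝ (suc x) = false
  ｛ suc y ｝ zero    = false
  ｛ suc y ｝ (suc x) = ｛ y ｝ x

  _∪_ _∩_ _─_ : BSet n → BSet n → BSet n
  (P ∪ Q) x = P x ∨ Q x
  (P ∩ Q) x = P x ∧ Q x
  (P ─ Q) x = P x ∧ not (Q x)

  x∈｛x｝ : ∀ (x : Fin n) → x ∈ ｛ x ｝
  x∈｛x｝ zero    = refl
  x∈｛x｝ (suc x) = x∈｛x｝ x

  ∈｛｝⇒≡ : x ∈ ｛ y ｝ → x ≡ y
  ∈｛｝⇒≡ {x = zero}  {y = zero}  _  = refl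
  ∈｛｝⇒≡ {x = suc x} {y = suc y} x∈ = cong suc (∈｛｝⇒≡ x∈)

  ≢⇒∉｛｝ : x ≢ y → x ∉ ｛ y ｝
  ≢⇒∉｛｝ {x = zero}  {y = zero}  x≢y = ⊥-elim (x≢y refl)
  ≢⇒∉｛｝ {x = zero}  {y = suc y} _   = refl
  ≢⇒∉｛｝ {x = suc x} {y = zero}  _   = refl
  ≢⇒∉｛｝ {x = suc x} {y = suc y} x≢y = ≢⇒∉｛｝ (x≢y ∘ cong suc)

  x∈full : x ∈ full
  x∈full = refl

  x∉∅ : x ∉ ∅
  x∉∅ = refl

  ∪⁺ˡ : x ∈ P → x ∈ P ∪ Q
  ∪⁺ˡ x∈P rewrite x∈P = refl

  ∪⁺ʳ : x ∈ Q → x ∈ P ∪ Q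
  ∪⁺ʳ {x = x} {P = P} x∈Q rewrite x∈Q with P x
  ... | true  = refl
  ... | false = refl

  ∪⁻ : x ∈ P ∪ Q → x ∈ P ⊎ x ∈ Q
  ∪⁻ {x = x} {P = P} x∈ with P x
  ... | true  = inj₁ refl
  ... | false = inj₂ x∈

  ∩⁺ : x ∈ P → x ∈ Q → x ∈ P ∩ Q
  ∩⁺ x∈P x∈Q rewrite x∈P | x∈Q = refl

  ∩⁻ : x ∈ P ∩ Q → x ∈ P × x ∈ Q
  ∩⁻ {x = x} {P = P} x∈ with P x
  ... | true = refl , x∈

  ─⁺ : x ∈ P → x ∉ Q → x ∈ P ─ Q
  ─⁺ x∈P x∉Q rewrite x∈P | x∉Q = refl

  ─⁻ : x ∈ P ─ Q → x ∈ P × x ∉ Q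
  ─⁻ {x = x} {P = P} {Q = Q} x∈ with P x | Q x
  ... | true | false = refl , refl

infixl 5 _-_

_-_ : BSet n → Fin n → BSet n
P - y = P ─ ｛ y ｝

-⁺ : x ∈ P → x ≢ y → x ∈ P - y
-⁺ x∈P x≢y = ─⁺ x∈P (≢⇒∉｛｝ x≢y)

-⁻ : x ∈ P - y → x ∈ P × x ≢ y
-⁻ {x = x} x∈ = let (x∈P , x∉y) = ─⁻ x∈ in
  x∈P , λ { refl → ∉⇒¬∈ x∉y (x∈｛x｝ x) }

y∈P∪｛y｝ : ∀ {P : BSet n} y → y ∈ P ∪ ｛ y ｝
y∈P∪｛y｝ y = ∪⁺ʳ (x∈｛x｝ y)

∈P∪｛y｝⁻ : x ∈ P ∪ ｛ y ｝ → x ∈ P ⊎ x ≡ y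
∈P∪｛y｝⁻ x∈ with ∪⁻ x∈
... | inj₁ x∈P = inj₁ x∈P
... | inj₂ x∈y = inj₂ (∈｛｝⇒≡ x∈y)

∉P∪｛y｝ : x ∉ P → x ≢ y → x ∉ P ∪ ｛ y ｝
∉P∪｛y｝ x∉P x≢y = ¬∈⇒∉ λ x∈ → [ ∉⇒¬∈ x∉P , x≢y ]′ (∈P∪｛y｝⁻ x∈)

∪｛｝-⊆ : P ⊆ Q → y ∈ Q → P ∪ ｛ y ｝ ⊆ Q
∪｛｝-⊆ P⊆Q y∈Q x x∈ with ∈P∪｛y｝⁻ x∈
... | inj₁ x∈P = P⊆Q x x∈P
... | inj₂ refl = y∈Q

｛｝-⊆ : y ∈ Q → ｛ y ｝ ⊆ Q
｛｝-⊆ y∈Q x x∈ rewrite ∈｛｝⇒≡ x∈ = y∈Q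

⊆-∪ˡ : P ⊆ P ∪ Q
⊆-∪ˡ _ = ∪⁺ˡ

𝟙 : Bool → ℕ
𝟙 true  = 1
𝟙 false = 0

opaque
  ∣_∣ : BSet n → ℕ
  ∣ P ∣ = ∑[ x < _ ] 𝟙 (P x)

  ∣∅∣≡0 : ∣ ∅ {n} ∣ ≡ 0
  ∣∅∣≡0 {zero}  = refl
  ∣∅∣≡0 {suc n} = ∣∅∣≡0 {n}

  ∣full∣≡n : ∣ full {n} ∣ ≡ n
  ∣full∣≡n {zero}  = refl
  ∣full∣≡n {suc n} = cong suc (∣full∣≡n {n})

opaque
  unfolding ｛_｝ ∣_∣

  ∣｛x｝∣≡1 : ∀ (x : Fin n) → ∣ ｛ x ｝ ∣ ≡ 1
  ∣｛x｝∣≡1 {suc n} zero    = cong suc (∣∅∣≡0 {n})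
  ∣｛x｝∣≡1 {suc n} (suc x) = ∣｛x｝∣≡1 x

  ∣∣-cong : P ⊆ Q → Q ⊆ P → ∣ P ∣ ≡ ∣ Q ∣
  ∣∣-cong {P = P} {Q = Q} P⊆Q Q⊆P = sum-cong-≗ (cong 𝟙 ∘ pointwise)
    where
    pointwise : ∀ x → P x ≡ Q x
    pointwise x with P x in Px | Q x in Qx
    ... | true  | true  = refl
    ... | false | false = refl
    ... | true  | false = sym (trans (sym Qx) (P⊆Q x Px))
    ... | false | true  = trans (sym Px) (Q⊆P x Qx)

  𝟙-mono : (x ∈ P → x ∈ Q) → 𝟙 (P x) ≤ 𝟙 (Q x)
  𝟙-mono {x = x} {P = P} P→Q with P x
  ... | false = z≤n
  ... | true rewrite P→Q refl = ≤-refl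

  𝟙-reflects : 𝟙 (P x) ≡ 𝟙 (Q x) → x ∈ Q → x ∈ P
  𝟙-reflects {P = P} {x = x} eq x∈Q with P x
  ... | true = refl
  ... | false rewrite x∈Q with eq
  ... | ()

  ∣∣-split : ∀ (P Q : BSet n) → ∣ P ∣ ≡ ∣ P ∩ Q ∣ + ∣ P ─ Q ∣
  ∣∣-split P Q = trans (sum-cong-≗ (λ x → split (P x) (Q x)))
    (∑-distrib-+ (λ x → 𝟙 (P x ∧ Q x)) (λ x → 𝟙 (P x ∧ not (Q x))))
    where
    split : ∀ a b → 𝟙 a ≡ 𝟙 (a ∧ b) + 𝟙 (a ∧ not b)
    split true  true  = refl
    split true  false = refl
    split false _     = refl

  ∣∣-disjoint-∪ : (∀ x → x ∈ P → x ∉ Q) → ∣ P ∪ Q ∣ ≡ ∣ P ∣ + ∣ Q ∣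
  ∣∣-disjoint-∪ {P = P} {Q = Q} disj =
    trans (sum-cong-≗ (λ x → union (P x) (Q x) (disj x))) (∑-distrib-+ (𝟙 ∘ P) (𝟙 ∘ Q))
    where
    union : ∀ a b → (a ≡ true → b ≡ false) → 𝟙 (a ∨ b) ≡ 𝟙 a + 𝟙 b
    union true  b a→¬b rewrite a→¬b refl = refl
    union false b _ = refl

  ∣∣-mono : P ⊆ Q → ∣ P ∣ ≤ ∣ Q ∣
  ∣∣-mono {P = P} {Q = Q} P⊆Q = sum-mono-≤ (λ x → 𝟙-mono {x = x} {P = P} {Q = Q} (P⊆Q x))

  ⊆∧∣∣≥⇒⊇ : P ⊆ Q → ∣ Q ∣ ≤ ∣ P ∣ → Q ⊆ P
  ⊆∧∣∣≥⇒⊇ {P = P} {Q = Q} P⊆Q ∣Q∣≤∣P∣ x = 𝟙-reflects {P = P} {x = x} {Q = Q}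
    (sum-squeeze (λ y → 𝟙-mono {x = y} {P = P} {Q = Q} (P⊆Q y)) ∣Q∣≤∣P∣ x)

¬∉⇒∈ : ¬ x ∉ P → x ∈ P
¬∉⇒∈ {x = x} {P = P} ¬x∉P with ∈-or-∉ x P
... | inj₁ x∈P = x∈P
... | inj₂ x∉P = ⊥-elim (¬x∉P x∉P)

⊆-∉ : P ⊆ Q → x ∉ Q → x ∉ P
⊆-∉ {x = x} P⊆Q x∉Q = ¬∈⇒∉ λ x∈P → ∉⇒¬∈ x∉Q (P⊆Q x x∈P)

x∉P-x : ∀ {P : BSet n} x → x ∉ P - x
x∉P-x x = ¬∈⇒∉ λ x∈ → -⁻ x∈ .proj₂ refl

∉-⇒∉ : x ∉ P - y → x ≢ y → x ∉ P
∉-⇒∉ x∉ x≢y = ¬∈⇒∉ λ x∈P → ∉⇒¬∈ x∉ (-⁺ x∈P x≢y)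

∉⇒∉- : x ∉ P → x ∉ P - y
∉⇒∉- x∉P = ¬∈⇒∉ λ x∈ → ∉⇒¬∈ x∉P (-⁻ x∈ .proj₁)

∉─⇒∉ : x ∉ P ─ Q → x ∉ Q → x ∉ P
∉─⇒∉ x∉ x∉Q = ¬∈⇒∉ λ x∈P → ∉⇒¬∈ x∉ (─⁺ x∈P x∉Q)

∈? : ∀ x (P : BSet n) → Dec (x ∈ P)
∈? x P with ∈-or-∉ x P
... | inj₁ x∈P = yes x∈P
... | inj₂ x∉P = no (∉⇒¬∈ x∉P)

∣∣-empty : (∀ x → ¬ x ∈ P) → ∣ P ∣ ≡ 0
∣∣-empty {n} ¬∈ = trans (∣∣-cong (λ x x∈ → ⊥-elim (¬∈ x x∈)) (λ x x∈ → ⊥-elim (∉⇒¬∈ x∉∅ x∈))) (∣∅∣≡0 {n})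

∣P∪｛x｝∣≡1+∣P∣ : x ∉ P → ∣ P ∪ ｛ x ｝ ∣ ≡ suc ∣ P ∣
∣P∪｛x｝∣≡1+∣P∣ {x = x} {P = P} x∉P = begin
  ∣ P ∪ ｛ x ｝ ∣    ≡⟨ ∣∣-disjoint-∪ (λ y y∈P → ≢⇒∉｛｝ λ { refl → ∉⇒¬∈ x∉P y∈P }) ⟩
  ∣ P ∣ + ∣ ｛ x ｝ ∣ ≡⟨ cong (∣ P ∣ +_) (∣｛x｝∣≡1 x) ⟩
  ∣ P ∣ + 1         ≡⟨ +-comm ∣ P ∣ 1 ⟩
  suc ∣ P ∣         ∎
  where open ≡-Reasoning

∣P∣≡∣Q∣+∣P─Q∣ : Q ⊆ P → ∣ P ∣ ≡ ∣ Q ∣ + ∣ P ─ Q ∣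
∣P∣≡∣Q∣+∣P─Q∣ {Q = Q} {P = P} Q⊆P = trans (∣∣-split P Q)
  (cong (_+ ∣ P ─ Q ∣) (∣∣-cong (λ _ x∈ → ∩⁻ x∈ .proj₂) (λ x x∈Q → ∩⁺ (Q⊆P x x∈Q) x∈Q)))

∣P∣≡1+∣P-x∣ : x ∈ P → ∣ P ∣ ≡ suc ∣ P - x ∣
∣P∣≡1+∣P-x∣ {x = x} {P = P} x∈P = trans (∣P∣≡∣Q∣+∣P─Q∣ (｛｝-⊆ x∈P)) (cong (_+ ∣ P - x ∣) (∣｛x｝∣≡1 x))

∣｛x｝∪｛y｝∣≡2 : x ≢ y → ∣ ｛ x ｝ ∪ ｛ y ｝ ∣ ≡ 2
∣｛x｝∪｛y｝∣≡2 {x = x} x≢y = trans (∣P∪｛x｝∣≡1+∣P∣ (≢⇒∉｛｝ (x≢y ∘ sym))) (cong suc (∣｛x｝∣≡1 x))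

∣｛x｝∣≤ : ∀ {x : Fin n} → 1 ≤ m → ∣ ｛ x ｝ ∣ ≤ m
∣｛x｝∣≤ {x = x} 1≤m = ≤-trans (≤-reflexive (∣｛x｝∣≡1 x)) 1≤m

｛x｝∪｛y｝⊆ : x ∈ P → y ∈ P → ｛ x ｝ ∪ ｛ y ｝ ⊆ P
｛x｝∪｛y｝⊆ x∈P y∈P = ∪｛｝-⊆ (｛｝-⊆ x∈P) y∈P

∃∈ : 0 < ∣ P ∣ → ∃[ x ] x ∈ P
∃∈ {P = P} 0<∣P∣ with any? (λ x → ∈? x P)
... | yes ∃x∈P = ∃x∈P
... | no ¬∃x∈P = ⊥-elim (<-irrefl (sym (∣∣-empty λ x x∈P → ¬∃x∈P (x , x∈P))) 0<∣P∣)

∃∈─ : ∣ P ∣ < ∣ Q ∣ → ∃[ x ] x ∈ Q × x ∉ P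
∃∈─ {P = P} {Q = Q} ∣P∣<∣Q∣ = let (x , x∈Q─P) = ∃∈ 0<∣Q─P∣ in x , ─⁻ x∈Q─P
  where
  0<∣Q─P∣ : 0 < ∣ Q ─ P ∣
  0<∣Q─P∣ = +-cancelˡ-< ∣ Q ∩ P ∣ _ _ (begin-strict
    ∣ Q ∩ P ∣ + 0         ≡⟨ +-identityʳ _ ⟩
    ∣ Q ∩ P ∣             ≤⟨ ∣∣-mono {P = Q ∩ P} (λ _ x∈ → ∩⁻ x∈ .proj₂) ⟩
    ∣ P ∣                 <⟨ ∣P∣<∣Q∣ ⟩
    ∣ Q ∣                 ≡⟨ ∣∣-split Q P ⟩
    ∣ Q ∩ P ∣ + ∣ Q ─ P ∣ ∎)
    where open ≤-Reasoning

∃∈-≢ : 2 ≤ ∣ P ∣ → ∀ y → ∃[ x ] x ∈ P × x ≢ y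
∃∈-≢ 2≤∣P∣ y with ∃∈─ {P = ｛ y ｝} (≤-trans (≤-reflexive (cong suc (∣｛x｝∣≡1 y))) 2≤∣P∣)
... | x , x∈P , x∉y = x , x∈P , λ { refl → ∉⇒¬∈ x∉y (x∈｛x｝ x) }

∃₂∈ : 2 ≤ ∣ P ∣ → ∃[ x ] ∃[ y ] x ∈ P × y ∈ P × x ≢ y
∃₂∈ 2≤∣P∣ with ∃∈ (≤-trans (s≤s z≤n) 2≤∣P∣)
... | x , x∈P with ∃∈-≢ 2≤∣P∣ x
... | y , y∈P , y≢x = x , y , x∈P , y∈P , y≢x ∘ sym

∣∣≡0⇒∉ : ∣ P ∣ ≡ 0 → ∀ x → x ∉ P
∣∣≡0⇒∉ ∣P∣≡0 x = ¬∈⇒∉ λ x∈P → 0≢1+n (trans (sym ∣P∣≡0) (∣P∣≡1+∣P-x∣ x∈P))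

∣∣≡1⇒≡ : ∣ P ∣ ≡ 1 → x ∈ P → y ∈ P → x ≡ y
∣∣≡1⇒≡ {x = x} {y = y} ∣P∣≡1 x∈P y∈P with x ≟ y
... | yes x≡y = x≡y
... | no  x≢y = ⊥-elim (∉⇒¬∈ (∣∣≡0⇒∉ ∣P-x∣≡0 y) (-⁺ y∈P (x≢y ∘ sym)))
  where
  ∣P-x∣≡0 = suc-injective (trans (sym (∣P∣≡1+∣P-x∣ x∈P)) ∣P∣≡1)

≡⇒∣∣≤1 : (∀ {x y} → x ∈ P → y ∈ P → x ≡ y) → ∣ P ∣ ≤ 1
≡⇒∣∣≤1 {P = P} unique with any? (λ x → ∈? x P)
... | no ¬∃x∈P = ≤-trans (≤-reflexive (∣∣-empty λ x x∈P → ¬∃x∈P (x , x∈P))) z≤n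
... | yes (x , x∈P) = ≤-reflexive (trans (∣P∣≡1+∣P-x∣ x∈P) (cong suc (∣∣-empty P-x-empty)))
  where
  P-x-empty : ∀ y → ¬ y ∈ P - x
  P-x-empty y y∈ = let (y∈P , y≢x) = -⁻ y∈ in y≢x (unique y∈P x∈P)

∃-between : A ⊆ P → ∣ A ∣ ≤ m → m ≤ ∣ P ∣ → ∃[ Q ] A ⊆ Q × Q ⊆ P × ∣ Q ∣ ≡ m
∃-between {A = A} {P = P} {m = m} A⊆P ∣A∣≤m m≤∣P∣ =
  shrink (∣ P ∣ ∸ m) P A⊆P (λ _ x∈P → x∈P) (trans (sym (m∸n+n≡m m≤∣P∣)) refl)
  where
  shrink : ∀ d P′ → A ⊆ P′ → P′ ⊆ P → ∣ P′ ∣ ≡ d + m → ∃[ Q ] A ⊆ Q × Q ⊆ P × ∣ Q ∣ ≡ m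
  shrink zero    P′ A⊆P′ P′⊆P ∣P′∣ = P′ , A⊆P′ , P′⊆P , ∣P′∣
  shrink (suc d) P′ A⊆P′ P′⊆P ∣P′∣ =
    let (x , x∈P′ , x∉A) = ∃∈─ (≤-trans (s≤s ∣A∣≤m) (≤-trans (s≤s (m≤n+m m d)) (≤-reflexive (sym ∣P′∣))))
    in shrink d (P′ - x)
         (λ y y∈A → -⁺ (A⊆P′ y y∈A) λ { refl → ∉⇒¬∈ x∉A y∈A })
         (λ y y∈ → P′⊆P y (-⁻ y∈ .proj₁))
         (suc-injective (trans (sym (∣P∣≡1+∣P-x∣ x∈P′)) ∣P′∣))

∃-subset : ∀ {n m} {P : BSet n} → m ≤ ∣ P ∣ → ∃[ Q ] Q ⊆ P × ∣ Q ∣ ≡ m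
∃-subset {n} {m} m≤∣P∣ with ∃-between {A = ∅} (λ x x∈∅ → ⊥-elim (∉⇒¬∈ x∉∅ x∈∅)) ∣∅∣≤m m≤∣P∣
  where
  ∣∅∣≤m : ∣ ∅ {n} ∣ ≤ m
  ∣∅∣≤m = subst (_≤ m) (sym (∣∅∣≡0 {n})) z≤n
... | Q , _ , Q⊆P , ∣Q∣ = Q , Q⊆P , ∣Q∣

infixr 5 _◃_

opaque
  unfolding ∣_∣ _∈_

  _ᵀ : (Fin m → BSet n) → Fin n → BSet m
  (F ᵀ) j i = F i j

  ∈ᵀ⁺ : ∀ {F : Fin m → BSet n} {i j} → j ∈ F i → i ∈ (F ᵀ) j
  ∈ᵀ⁺ j∈ = j∈

  ∈ᵀ⁻ : ∀ {F : Fin m → BSet n} {i j} → i ∈ (F ᵀ) j → j ∈ F i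
  ∈ᵀ⁻ i∈ = i∈

  ∑∣∣ᵀ : (F : Fin m → BSet n) → ∑[ i < m ] ∣ F i ∣ ≡ ∑[ j < n ] ∣ (F ᵀ) j ∣
  ∑∣∣ᵀ F = ∑-comm (λ i j → 𝟙 (F i j))

  ∑-indicator-≤ : ∀ {f : Fin n → ℕ} {c} → (∀ x → x ∈ A → f x ≤ c) → (∀ x → x ∉ A → f x ≡ 0) →
                  ∑[ x < n ] f x ≤ ∣ A ∣ * c
  ∑-indicator-≤ {A = A} {f = f} {c} inside outside =
    ≤-trans (sum-mono-≤ pointwise) (≤-reflexive (sym (*-distribʳ-sum c (𝟙 ∘ A))))
    where
    pointwise : ∀ x → f x ≤ 𝟙 (A x) * c
    pointwise x with A x in Ax
    ... | true  = ≤-trans (inside x Ax) (≤-reflexive (sym (+-identityʳ c)))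
    ... | false = ≤-reflexive (outside x Ax)

  ∑-indicator : ∀ {f : Fin n → ℕ} {c} → (∀ x → x ∈ A → f x ≡ c) → (∀ x → x ∉ A → f x ≡ 0) →
                ∑[ x < n ] f x ≡ ∣ A ∣ * c
  ∑-indicator {A = A} {f = f} {c} inside outside =
    trans (sum-cong-≗ pointwise) (sym (*-distribʳ-sum c (𝟙 ∘ A)))
    where
    pointwise : ∀ x → f x ≡ 𝟙 (A x) * c
    pointwise x with A x in Ax
    ... | true  = trans (inside x Ax) (sym (+-identityʳ c))
    ... | false = outside x Ax

  _◃_ : BSet m → (Fin m → BSet n) → Fin m → BSet n
  (A ◃ F) i j = A i ∧ F i j

  ∈◃⁺ : ∀ {F : Fin m → BSet n} {i j} → i ∈ A → j ∈ F i → j ∈ (A ◃ F) i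
  ∈◃⁺ i∈A j∈ rewrite i∈A = j∈

  ∈◃⁻ : ∀ {F : Fin m → BSet n} {i j} → j ∈ (A ◃ F) i → i ∈ A × j ∈ F i
  ∈◃⁻ {A = A} {i = i} j∈ with A i
  ... | true = refl , j∈

opaque
  unfolding ∣_∣ ｛_｝

  ∣tabulate∣ : ∀ (f : Fin n → Bool) → Subset.∣ tabulate f ∣ ≡ ∣ f ∣
  ∣tabulate∣ {zero}  f = refl
  ∣tabulate∣ {suc n} f with f zero
  ... | true  = cong suc (∣tabulate∣ (f ∘ suc))
  ... | false = ∣tabulate∣ (f ∘ suc)

  lookup∁⁅v⁆ : ∀ (v w : Fin n) → lookup (∁ ⁅ v ⁆) w ≡ not (｛ v ｝ w)
  lookup∁⁅v⁆ zero    zero    = refl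
  lookup∁⁅v⁆ {suc n} zero (suc w) = trans (lookup-map w not (Subset.⊥ {n})) (cong not (lookup-replicate w false))
  lookup∁⁅v⁆ (suc v) zero    = refl
  lookup∁⁅v⁆ (suc v) (suc w) = lookup∁⁅v⁆ v w

δ : Fin n → Fin n → ℕ
δ x y = 𝟙 (｛ x ｝ y)

opaque
  unfolding _∈_

  δ-∈ : y ∈ ｛ x ｝ → δ x y ≡ 1
  δ-∈ = cong 𝟙

  δ-∉ : y ∉ ｛ x ｝ → δ x y ≡ 0
  δ-∉ = cong 𝟙

δ-diag : ∀ (x : Fin n) → δ x x ≡ 1
δ-diag x = δ-∈ (x∈｛x｝ x)

δ-off : y ≢ x → δ x y ≡ 0
δ-off = δ-∉ ∘ ≢⇒∉｛｝

∑-δ : ∀ x (f : Fin n → ℕ) → ∑[ y < n ] (δ x y * f y) ≡ f x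
∑-δ x f = trans (∑-indicator {A = ｛ x ｝} on off) (trans (cong (_* f x) (∣｛x｝∣≡1 x)) (+-identityʳ (f x)))
  where
  on : ∀ y → y ∈ ｛ x ｝ → δ x y * f y ≡ f x
  on y y∈ rewrite ∈｛｝⇒≡ y∈ | δ-diag x = +-identityʳ (f x)
  off : ∀ y → y ∉ ｛ x ｝ → δ x y * f y ≡ 0
  off y y∉ rewrite δ-∉ y∉ = refl

∣P─Q∣≡r : ∀ {q r} → Q ⊆ P → ∣ Q ∣ ≡ q → ∣ P ∣ ≡ q + r → ∣ P ─ Q ∣ ≡ r
∣P─Q∣≡r {Q = Q} {P = P} {q} Q⊆P ∣Q∣ ∣P∣ =
  +-cancelˡ-≡ q _ _ (trans (sym (trans (∣P∣≡∣Q∣+∣P─Q∣ Q⊆P) (cong (_+ ∣ P ─ Q ∣) ∣Q∣))) ∣P∣)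

∣P─Q∣≡∣P∣∸∣Q∣ : Q ⊆ P → ∣ P ─ Q ∣ ≡ ∣ P ∣ ∸ ∣ Q ∣
∣P─Q∣≡∣P∣∸∣Q∣ {Q = Q} {P = P} Q⊆P = sym (trans (cong (_∸ ∣ Q ∣) (∣P∣≡∣Q∣+∣P─Q∣ Q⊆P)) (m+n∸m≡n ∣ Q ∣ ∣ P ─ Q ∣))

∣P∩Q∣≡∣Q∩P∣ : ∀ (P Q : BSet n) → ∣ P ∩ Q ∣ ≡ ∣ Q ∩ P ∣
∣P∩Q∣≡∣Q∩P∣ P Q = ∣∣-cong (λ _ x∈ → let (x∈P , x∈Q) = ∩⁻ x∈ in ∩⁺ x∈Q x∈P)
                          (λ _ x∈ → let (x∈Q , x∈P) = ∩⁻ x∈ in ∩⁺ x∈P x∈Q)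

∣P∩full∣ : ∀ (P : BSet n) → ∣ P ∩ full ∣ ≡ ∣ P ∣
∣P∩full∣ P = ∣∣-cong (λ _ x∈ → ∩⁻ x∈ .proj₁) (λ _ x∈ → ∩⁺ x∈ x∈full)

-- Arithmetic

amgm-gap : ∀ x a → ∃[ d ] x * x + a * a ≡ 2 * a * x + d * d × (d ≡ 0 → x ≡ a)
amgm-gap x a with ≤-total x a
... | inj₁ x≤a with m≤n⇒∃[o]m+o≡n x≤a
...   | d , refl = d , gap x d , λ { refl → sym (+-identityʳ x) }
  where
  gap : ∀ x d → x * x + (x + d) * (x + d) ≡ 2 * (x + d) * x + d * d
  gap = solve-∀
amgm-gap x a | inj₂ a≤x with m≤n⇒∃[o]m+o≡n a≤x
...   | d , refl = d , gap a d , λ { refl → +-identityʳ a }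
  where
  gap : ∀ a d → (a + d) * (a + d) + a * a ≡ 2 * a * (a + d) + d * d
  gap = solve-∀

2ax≤x²+a² : ∀ x a → 2 * a * x ≤ x * x + a * a
2ax≤x²+a² x a = let (d , gap , _) = amgm-gap x a in ≤-trans (m≤m+n _ (d * d)) (≤-reflexive (sym gap))

2ax≡x²+a²⇒x≡a : ∀ {x a} → 2 * a * x ≡ x * x + a * a → x ≡ a
2ax≡x²+a²⇒x≡a {x} {a} eq with amgm-gap x a
... | d , gap , d≡0⇒x≡a =
  d≡0⇒x≡a (m*m≡0⇒m≡0 (sym (+-cancelˡ-≡ (2 * a * x) 0 (d * d) (trans (+-identityʳ _) (trans eq gap)))))
  where
  m*m≡0⇒m≡0 : ∀ {m} → m * m ≡ 0 → m ≡ 0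
  m*m≡0⇒m≡0 {zero} _ = refl

m*m≡m*[m∸1]+m : ∀ m → m * m ≡ m * (m ∸ 1) + m
m*m≡m*[m∸1]+m zero    = refl
m*m≡m*[m∸1]+m (suc m) = trans (*-suc (suc m) m) (+-comm (suc m) _)

-- p = α - 1, d = k - 1 - α, M = n - 2 and q = β - 1 in the notation of `diregular-parameters`.
parameters-forced : ∀ p d M q → (2 + p + d) * (1 + p + d) ≡ (1 + M) * (1 + p) →
                    (1 + p) * (p + d) ≡ M * (1 + q) → p * (p ∸ 1) ≡ (p + d) * q → d ≡ 0 × M ≡ 1 + p
parameters-forced p d M q E1 E2 E3 = d≡0 , M≡1+p
  where
  open ≡-Reasoning
  M[p²+d] : M * (p * p + d) ≡ (1 + p) * ((p + d) * (p + d))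
  M[p²+d] = begin
    M * (p * p + d)                 ≡⟨ cong (λ z → M * (z + d)) (m*m≡m*[m∸1]+m p) ⟩
    M * (p * (p ∸ 1) + p + d)       ≡⟨ cong (λ z → M * (z + p + d)) E3 ⟩
    M * ((p + d) * q + p + d)       ≡⟨ solve (M ∷ p ∷ d ∷ q ∷ []) ⟩
    (p + d) * (M * (1 + q))         ≡⟨ cong ((p + d) *_) (sym E2) ⟩
    (p + d) * ((1 + p) * (p + d))   ≡⟨ solve (p ∷ d ∷ []) ⟩
    (1 + p) * ((p + d) * (p + d))   ∎
  M[1+p] : M * (1 + p) ≡ (1 + p + d) * (1 + p + d) + d
  M[1+p] = +-cancelˡ-≡ (1 + p) _ _ (begin
    (1 + p) + M * (1 + p)                     ≡⟨ solve (p ∷ M ∷ []) ⟩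
    (1 + M) * (1 + p)                         ≡⟨ sym E1 ⟩
    (2 + p + d) * (1 + p + d)                 ≡⟨ solve (p ∷ d ∷ []) ⟩
    (1 + p) + ((1 + p + d) * (1 + p + d) + d) ∎)
  d[1+d]²≡0 : d * ((1 + d) * (1 + d)) ≡ 0
  d[1+d]²≡0 = sym (+-cancelˡ-≡ ((1 + p) * (1 + p) * ((p + d) * (p + d))) _ _ (begin
    (1 + p) * (1 + p) * ((p + d) * (p + d)) + 0     ≡⟨ solve (p ∷ d ∷ []) ⟩
    (1 + p) * ((1 + p) * ((p + d) * (p + d)))       ≡⟨ cong ((1 + p) *_) (sym M[p²+d]) ⟩
    (1 + p) * (M * (p * p + d))                     ≡⟨ solve (p ∷ M ∷ d ∷ []) ⟩
    (M * (1 + p)) * (p * p + d)                     ≡⟨ cong (_* (p * p + d)) M[1+p] ⟩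
    ((1 + p + d) * (1 + p + d) + d) * (p * p + d)   ≡⟨ solve (p ∷ d ∷ []) ⟩
    (1 + p) * (1 + p) * ((p + d) * (p + d)) + d * ((1 + d) * (1 + d)) ∎))
  d≡0 : d ≡ 0
  d≡0 = m*n≡0⇒m≡0 d ((1 + d) * (1 + d)) d[1+d]²≡0
  M≡1+p : M ≡ 1 + p
  M≡1+p = *-cancelʳ-≡ M (1 + p) (1 + p) (begin
    M * (1 + p)                               ≡⟨ M[1+p] ⟩
    (1 + p + d) * (1 + p + d) + d             ≡⟨ cong (λ d → (1 + p + d) * (1 + p + d) + d) d≡0 ⟩
    (1 + p + 0) * (1 + p + 0) + 0             ≡⟨ solve (p ∷ []) ⟩
    (1 + p) * (1 + p)                         ∎)

diregular-parameters : ∀ {k n α β} → 1 ≤ α → α < k → 2 ≤ n → 1 ≤ β →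
  k * (k ∸ 1) ≡ (n ∸ 1) * α → α * (k ∸ 2) ≡ (n ∸ 2) * β → (α ∸ 1) * (α ∸ 2) ≡ (k ∸ 2) * (β ∸ 1) →
  n ≡ suc k
diregular-parameters {n = suc (suc M)} {α = suc p} {β = suc q} (s≤s z≤n) α<k (s≤s (s≤s z≤n)) (s≤s z≤n)
  with m≤n⇒∃[o]m+o≡n α<k
... | d , refl = λ E1 E2 E3 → let (d≡0 , M≡1+p) = parameters-forced p d M q E1 E2 E3 in
  cong (λ m → suc (suc m)) (trans M≡1+p (cong suc (sym (trans (cong (p +_) d≡0) (+-identityʳ p)))))

variance-identity : ∀ k n α → 1 ≤ k → 1 ≤ n → k * (k ∸ 1) ≡ (n ∸ 1) * α →
  k * ((k ∸ 1) * α) + k * k + n * (α * α) + 2 * α * k ≡ 2 * α * (k * k) + (k * k + α * α)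
variance-identity (suc k) (suc n) α _ _ E = begin
  suc k * (k * α) + suc k * suc k + suc n * (α * α) + 2 * α * suc k
    ≡⟨ solve (k ∷ n ∷ α ∷ []) ⟩
  (suc k * k) * α + (suc k * suc k + suc n * (α * α) + 2 * α * suc k)
    ≡⟨ cong (λ c → c * α + (suc k * suc k + suc n * (α * α) + 2 * α * suc k)) E ⟩
  (n * α) * α + (suc k * suc k + suc n * (α * α) + 2 * α * suc k)
    ≡⟨ solve (k ∷ n ∷ α ∷ []) ⟩
  2 * α * (n * α) + (suc k * suc k + α * α + 2 * α * suc k)
    ≡⟨ cong (λ c → 2 * α * c + (suc k * suc k + α * α + 2 * α * suc k)) (sym E) ⟩
  2 * α * (suc k * k) + (suc k * suc k + α * α + 2 * α * suc k)
    ≡⟨ solve (k ∷ α ∷ []) ⟩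
  2 * α * (suc k * suc k) + (suc k * suc k + α * α) ∎
  where open ≡-Reasoning

-- Liking digraphs

module _ (D : Digraph) where

  Vertex : Set
  Vertex = Fin (size D)

  VSet : Set
  VSet = BSet (size D)

  infix 4 _⟶_

  N⁺ N⁻ : Vertex → VSet
  N⁺ = arc D
  N⁻ w u = arc D u w

  _⟶_ : Vertex → Vertex → Set
  u ⟶ w = w ∈ N⁺ u

  opaque
    unfolding _∈_

    ∈N⁻⇒⟶ : ∀ {u w} → u ∈ N⁻ w → u ⟶ w
    ∈N⁻⇒⟶ u∈ = u∈

    ⟶⇒∈N⁻ : ∀ {u w} → u ⟶ w → u ∈ N⁻ w
    ⟶⇒∈N⁻ u⟶w = u⟶w

    v∉N⁺v : ∀ v → v ∉ N⁺ v
    v∉N⁺v = loopless D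

    -- `commonOut D (tabulate P)` is `tabulate (common⁺ P)` by definition.
    common⁺ : VSet → VSet
    common⁺ P w = ⌊ tabulate P ⊆? inNbr D w ⌋

    common⁺⁺ : ∀ {P w} → (∀ u → u ∈ P → u ⟶ w) → w ∈ common⁺ P
    common⁺⁺ {P} {w} all⟶w with tabulate P ⊆? inNbr D w
    ... | yes _  = refl
    ... | no P⊈ = ⊥-elim (P⊈ λ {u} u∈P → lookup⇒[]= u (inNbr D w)
      (trans (lookup∘tabulate (N⁻ w) u)
        (all⟶w u (trans (sym (lookup∘tabulate P u)) ([]=⇒lookup u∈P)))))

    common⁺⁻ : ∀ {P u w} → w ∈ common⁺ P → u ∈ P → u ⟶ w
    common⁺⁻ {P} {u} {w} w∈ u∈P with tabulate P ⊆? inNbr D w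
    ... | yes P⊆ = trans (sym (lookup∘tabulate (N⁻ w) u))
      ([]=⇒lookup (P⊆ (lookup⇒[]= u (tabulate P) (trans (lookup∘tabulate P u) u∈P))))

  ⟶-irrefl : ∀ {u w} → u ⟶ w → u ≢ w
  ⟶-irrefl {u} u⟶w refl = ∉⇒¬∈ (v∉N⁺v u) u⟶w

  common⁺-antitone : ∀ {P Q} → P ⊆ Q → common⁺ Q ⊆ common⁺ P
  common⁺-antitone P⊆Q w w∈ = common⁺⁺ λ u u∈P → common⁺⁻ w∈ (P⊆Q u u∈P)

  common⁺-∉ : ∀ {P w} → w ∈ common⁺ P → w ∉ P
  common⁺-∉ w∈ = ¬∈⇒∉ λ w∈P → ⟶-irrefl (common⁺⁻ w∈ w∈P) refl

  common⁺-∪｛｝ : ∀ {P u w} → w ∈ common⁺ P → u ⟶ w → w ∈ common⁺ (P ∪ ｛ u ｝)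
  common⁺-∪｛｝ w∈ u⟶w = common⁺⁺ λ x x∈ → [ common⁺⁻ w∈ , (λ { refl → u⟶w }) ]′ (∈P∪｛y｝⁻ x∈)

  ⟶⇒∈common⁺｛｝ : ∀ {v w} → v ⟶ w → w ∈ common⁺ ｛ v ｝
  ⟶⇒∈common⁺｛｝ v⟶w = common⁺⁺ λ u u∈ → subst (_⟶ _) (sym (∈｛｝⇒≡ u∈)) v⟶w

  -- The (s, μ)-liking condition of the induced subdigraph on W, without the condition s ≤ ∣ W ∣.
  LikingOn : VSet → ℕ → ℕ → Set
  LikingOn W s μ = ∀ P → P ⊆ W → ∣ P ∣ ≡ s → ∣ common⁺ P ∩ W ∣ ≡ μ

  CompleteOn : VSet → Set
  CompleteOn W = ∀ {u w} → u ∈ W → w ∈ W → u ≢ w → u ⟶ w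

  LikingOn-∪｛｝ : ∀ {W s μ T v} → LikingOn W (suc s) μ → T ⊆ W → v ∈ W → v ∉ T → ∣ T ∣ ≡ s →
                  ∣ common⁺ (T ∪ ｛ v ｝) ∩ W ∣ ≡ μ
  LikingOn-∪｛｝ liking T⊆W v∈W v∉T ∣T∣ =
    liking _ (∪｛｝-⊆ T⊆W v∈W) (trans (∣P∪｛x｝∣≡1+∣P∣ v∉T) (cong suc ∣T∣))

  ∣common⁺∣-full : ∀ {s μ} → LikingOn full s μ → ∀ {P} → ∣ P ∣ ≡ s → ∣ common⁺ P ∣ ≡ μ
  ∣common⁺∣-full liking {P} ∣P∣ = trans (sym (∣P∩full∣ (common⁺ P))) (liking P (λ _ _ → x∈full) ∣P∣)

  ∣common⁺∩full-x∣ : ∀ {P x μ} → x ∈ common⁺ P → ∣ common⁺ P ∣ ≡ μ → ∣ common⁺ P ∩ (full - x) ∣ ≡ μ ∸ 1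
  ∣common⁺∩full-x∣ {P} {x} {μ} x∈ ∣common⁺P∣ = begin
    ∣ common⁺ P ∩ (full - x) ∣ ≡⟨ ∣∣-cong (λ w w∈ → -⁺ (∩⁻ w∈ .proj₁) (-⁻ (∩⁻ w∈ .proj₂) .proj₂))
                                       (λ w w∈ → ∩⁺ (-⁻ w∈ .proj₁) (-⁺ x∈full (-⁻ w∈ .proj₂))) ⟩
    ∣ common⁺ P - x ∣          ≡⟨ cong (_∸ 1) (trans (sym (∣P∣≡1+∣P-x∣ x∈)) ∣common⁺P∣) ⟩
    μ ∸ 1                      ∎
    where open ≡-Reasoning

  ∣N⁺∩N⁺∣≡ : ∀ {α} → LikingOn full 2 α → ∀ {u u′} → u ≢ u′ → ∣ N⁺ u ∩ N⁺ u′ ∣ ≡ α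
  ∣N⁺∩N⁺∣≡ liking₂ {u} {u′} u≢u′ = trans (∣∣-cong ⊆common⁺ common⁺⊆) (∣common⁺∣-full liking₂ (∣｛x｝∪｛y｝∣≡2 u≢u′))
    where
    ⊆common⁺ : N⁺ u ∩ N⁺ u′ ⊆ common⁺ (｛ u ｝ ∪ ｛ u′ ｝)
    ⊆common⁺ w w∈ = common⁺-∪｛｝ (⟶⇒∈common⁺｛｝ (∩⁻ w∈ .proj₁)) (∩⁻ w∈ .proj₂)
    common⁺⊆ : common⁺ (｛ u ｝ ∪ ｛ u′ ｝) ⊆ N⁺ u ∩ N⁺ u′
    common⁺⊆ w w∈ = ∩⁺ (common⁺⁻ w∈ (∪⁺ˡ (x∈｛x｝ u))) (common⁺⁻ w∈ (y∈P∪｛y｝ u′))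

  LikingOn-1⇒outdeg : ∀ {W μ x} → LikingOn W 1 μ → x ∈ W → ∣ N⁺ x ∩ W ∣ ≡ μ
  LikingOn-1⇒outdeg {x = x} liking x∈W = trans
    (∣∣-cong (λ z z∈ → ∩⁺ (⟶⇒∈common⁺｛｝ (∩⁻ z∈ .proj₁)) (∩⁻ z∈ .proj₂))
             (λ z z∈ → ∩⁺ (common⁺⁻ (∩⁻ z∈ .proj₁) (x∈｛x｝ x)) (∩⁻ z∈ .proj₂)))
    (liking ｛ x ｝ (｛｝-⊆ x∈W) (∣｛x｝∣≡1 x))

  module OutRegular {W : VSet} {a b : ℕ}
    (liking : LikingOn W (2 + a) (1 + b))
    (outdeg : ∀ {x} → x ∈ W → ∣ N⁺ x ∩ W ∣ ≡ 2 + a + b) where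

    Nᵂ : Vertex → VSet
    Nᵂ v = N⁺ v ∩ W

    v∉Nᵂv : ∀ v → v ∉ Nᵂ v
    v∉Nᵂv v = ⊆-∉ (λ _ z∈ → ∩⁻ z∈ .proj₁) (v∉N⁺v v)

    N⁺-clique : ∀ {v x y} → v ∈ W → x ∈ Nᵂ v → y ∈ Nᵂ v → x ≢ y → x ⟶ y
    N⁺-clique {v} {x} {y} v∈W x∈ y∈ x≢y
      with ∃-between {P = Nᵂ v - y} {m = suc a} (｛｝-⊆ (-⁺ x∈ x≢y)) ∣｛x｝∣≤1+a 1+a≤∣Nᵂv-y∣
      where
      ∣｛x｝∣≤1+a = ∣｛x｝∣≤ (s≤s z≤n)
      1+a≤∣Nᵂv-y∣ = ≤-trans (s≤s (m≤m+n a b)) (≤-reflexive (suc-injective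
        (trans (sym (outdeg v∈W)) (∣P∣≡1+∣P-x∣ y∈))))
    ... | T , ｛x｝⊆T , T⊆Nᵂv-y , ∣T∣ = common⁺⁻ y∈common (∪⁺ˡ (｛x｝⊆T x (x∈｛x｝ x)))
      where
      T⊆Nᵂv : T ⊆ Nᵂ v
      T⊆Nᵂv z z∈T = -⁻ (T⊆Nᵂv-y z z∈T) .proj₁
      v∉T : v ∉ T
      v∉T = ⊆-∉ T⊆Nᵂv (v∉Nᵂv v)
      common⊆ : common⁺ (T ∪ ｛ v ｝) ∩ W ⊆ Nᵂ v ─ T
      common⊆ z z∈ = let (z∈common , z∈W) = ∩⁻ z∈ in
        ─⁺ (∩⁺ (common⁺⁻ z∈common (y∈P∪｛y｝ v)) z∈W) (⊆-∉ ⊆-∪ˡ (common⁺-∉ z∈common))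
      ∣Nᵂv─T∣ : ∣ Nᵂ v ─ T ∣ ≡ 1 + b
      ∣Nᵂv─T∣ = ∣P─Q∣≡r T⊆Nᵂv ∣T∣ (trans (outdeg v∈W) (cong suc (sym (+-suc a b))))
      y∈common : y ∈ common⁺ (T ∪ ｛ v ｝)
      y∈common = ∩⁻ (⊆∧∣∣≥⇒⊇ common⊆ (≤-reflexive (trans ∣Nᵂv─T∣
          (sym (LikingOn-∪｛｝ liking (λ z z∈ → ∩⁻ (T⊆Nᵂv z z∈) .proj₂) v∈W v∉T ∣T∣))))
        y (─⁺ y∈ (⊆-∉ T⊆Nᵂv-y (x∉P-x y)))) .proj₁

    module _ {v : Vertex} (v∈W : v ∈ W) where

      escape : Vertex → VSet
      escape u = Nᵂ u ─ (Nᵂ v - u)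

      ∈escape : ∀ {u z} → z ∈ Nᵂ u → z ∉ Nᵂ v → z ∈ escape u
      ∈escape z∈ z∉ = ─⁺ z∈ (∉⇒∉- z∉)

      escape-∉ : ∀ {u z} → z ∈ escape u → z ∉ Nᵂ v
      escape-∉ z∈ = let (z∈Nᵂu , z∉) = ─⁻ z∈ in
        ∉-⇒∉ z∉ (λ { refl → ∉⇒¬∈ (v∉N⁺v _) (∩⁻ z∈Nᵂu .proj₁) })

      ∣escape∣≡1 : ∀ {u} → u ∈ Nᵂ v → ∣ escape u ∣ ≡ 1
      ∣escape∣≡1 {u} u∈ = ∣P─Q∣≡r Nᵂv-u⊆Nᵂu
        (suc-injective (trans (sym (∣P∣≡1+∣P-x∣ u∈)) (outdeg v∈W)))
        (trans (outdeg (∩⁻ u∈ .proj₂)) (+-comm 1 (suc (a + b))))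
        where
        Nᵂv-u⊆Nᵂu : Nᵂ v - u ⊆ Nᵂ u
        Nᵂv-u⊆Nᵂu z z∈ = let (z∈Nᵂv , z≢u) = -⁻ z∈ in
          ∩⁺ (N⁺-clique v∈W u∈ z∈Nᵂv (z≢u ∘ sym)) (∩⁻ z∈Nᵂv .proj₂)

      escape-shared : ∀ {u u′ x} → u ∈ Nᵂ v → u′ ∈ Nᵂ v → x ∈ escape u → x ∈ escape u′
      escape-shared {u} {u′} {x} u∈ u′∈ x∈ with u ≟ u′
      ... | yes refl = x∈
      ... | no  u≢u′
        with ∃-between (｛x｝∪｛y｝⊆ u∈ u′∈) ∣pair∣≤2+a 2+a≤∣Nᵂv∣
        where
        ∣pair∣≤2+a = ≤-trans (≤-reflexive (∣｛x｝∪｛y｝∣≡2 u≢u′)) (s≤s (s≤s z≤n))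
        2+a≤∣Nᵂv∣ = ≤-trans (m≤m+n (2 + a) b) (≤-reflexive (sym (outdeg v∈W)))
      ... | S , pair⊆S , S⊆Nᵂv , ∣S∣
        with ∃∈─ {P = Nᵂ v ─ S} {Q = common⁺ S ∩ W}
               (≤-reflexive (trans (cong suc ∣Nᵂv─S∣) (sym (liking S S⊆W ∣S∣))))
        where
        S⊆W : S ⊆ W
        S⊆W y y∈ = ∩⁻ (S⊆Nᵂv y y∈) .proj₂
        ∣Nᵂv─S∣ : ∣ Nᵂ v ─ S ∣ ≡ b
        ∣Nᵂv─S∣ = ∣P─Q∣≡r S⊆Nᵂv ∣S∣ (outdeg v∈W)
      ... | z , z∈ , z∉ = subst (_∈ escape u′) (∣∣≡1⇒≡ (∣escape∣≡1 u∈) (z∈escape u∈S) x∈) (z∈escape u′∈S)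
        where
        u∈S = pair⊆S u (∪⁺ˡ (x∈｛x｝ u))
        u′∈S = pair⊆S u′ (y∈P∪｛y｝ u′)
        z∈escape : ∀ {u″} → u″ ∈ S → z ∈ escape u″
        z∈escape u″∈S = ∈escape (∩⁺ (common⁺⁻ (∩⁻ z∈ .proj₁) u″∈S) (∩⁻ z∈ .proj₂))
          (∉─⇒∉ z∉ (common⁺-∉ (∩⁻ z∈ .proj₁)))

      ∣Nᵂv∣ : a + (2 + b) ≡ ∣ Nᵂ v ∣
      ∣Nᵂv∣ = trans (trans (+-suc a (suc b)) (cong suc (+-suc a b))) (sym (outdeg v∈W))

      2≤∣Nᵂv∣ : 2 ≤ ∣ Nᵂ v ∣
      2≤∣Nᵂv∣ = ≤-trans (s≤s (s≤s z≤n)) (≤-reflexive (sym (outdeg v∈W)))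

      escape-⟶ : ∀ {u x y} → u ∈ Nᵂ v → x ∈ escape u → y ∈ Nᵂ v → x ⟶ y
      escape-⟶ {u} {x} {y} u∈ x∈ y∈ with ∃∈-≢ 2≤∣Nᵂv∣ y
      ... | u′ , u′∈ , u′≢y = N⁺-clique (∩⁻ u′∈ .proj₂) x∈Nᵂu′ y∈Nᵂu′ x≢y
        where
        x∈Nᵂu′ = ─⁻ (escape-shared u∈ u′∈ x∈) .proj₁
        y∈Nᵂu′ = ∩⁺ (N⁺-clique v∈W u′∈ y∈ u′≢y) (∩⁻ y∈ .proj₂)
        x≢y : x ≢ y
        x≢y refl = ∉⇒¬∈ (escape-∉ x∈) y∈

      N⁺-symmetric : ∀ {u} → u ∈ Nᵂ v → u ⟶ v
      N⁺-symmetric {u} u∈ = ¬∉⇒∈ u↛v-impossible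
        where
        u↛v-impossible : ¬ v ∉ N⁺ u
        u↛v-impossible u↛v with ∃∈ (≤-reflexive (sym (∣escape∣≡1 u∈)))
                              | ∃-subset {m = a} (≤-trans (m≤m+n a (2 + b)) (≤-reflexive ∣Nᵂv∣))
        ... | x , x∈ | T , T⊆Nᵂv , ∣T∣ = 1+n≰n (begin
          2 + b                            ≡⟨ sym (∣P─Q∣≡r T⊆Nᵂv ∣T∣ (sym ∣Nᵂv∣)) ⟩
          ∣ Nᵂ v ─ T ∣                     ≤⟨ ∣∣-mono Nᵂv─T⊆common ⟩
          ∣ common⁺ (T ∪ ｛ v ｝ ∪ ｛ x ｝) ∩ W ∣ ≡⟨ LikingOn-∪｛｝ liking T∪v⊆W x∈W x∉T∪v ∣T∪v∣ ⟩
          1 + b                            ∎)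
          where
          open ≤-Reasoning
          x∈W = ∩⁻ (─⁻ x∈ .proj₁) .proj₂
          x∉Nᵂv = escape-∉ x∈
          T∪v⊆W = ∪｛｝-⊆ (λ y y∈ → ∩⁻ (T⊆Nᵂv y y∈) .proj₂) v∈W
          x∉T∪v = ∉P∪｛y｝ (⊆-∉ T⊆Nᵂv x∉Nᵂv)
                    λ { refl → ∉⇒¬∈ u↛v (∩⁻ (─⁻ x∈ .proj₁) .proj₁) }
          ∣T∪v∣ = trans (∣P∪｛x｝∣≡1+∣P∣ (⊆-∉ T⊆Nᵂv (v∉Nᵂv v))) (cong suc ∣T∣)
          Nᵂv─T⊆common : Nᵂ v ─ T ⊆ common⁺ (T ∪ ｛ v ｝ ∪ ｛ x ｝) ∩ W
          Nᵂv─T⊆common z z∈ = ∩⁺ (common⁺⁺ sources⟶z) (∩⁻ z∈Nᵂv .proj₂)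
            where
            z∈Nᵂv = ─⁻ z∈ .proj₁
            sources⟶z : ∀ s → s ∈ T ∪ ｛ v ｝ ∪ ｛ x ｝ → s ⟶ z
            sources⟶z s s∈ with ∈P∪｛y｝⁻ s∈
            ... | inj₂ refl = escape-⟶ u∈ x∈ z∈Nᵂv
            ... | inj₁ s∈T∪v with ∈P∪｛y｝⁻ s∈T∪v
            ... | inj₂ refl = ∩⁻ z∈Nᵂv .proj₁
            ... | inj₁ s∈T = N⁺-clique v∈W (T⊆Nᵂv s s∈T) z∈Nᵂv λ { refl → ∉⇒¬∈ (─⁻ z∈ .proj₂) s∈T }

      N⁺-closed : ∀ {u z} → u ∈ Nᵂ v → z ∈ Nᵂ u → z ≡ v ⊎ z ∈ Nᵂ v
      N⁺-closed {u} {z} u∈ z∈ with ∈-or-∉ z (Nᵂ v)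
      ... | inj₁ z∈Nᵂv = inj₂ z∈Nᵂv
      ... | inj₂ z∉Nᵂv = inj₁ (∣∣≡1⇒≡ (∣escape∣≡1 u∈) (∈escape z∈ z∉Nᵂv) (∈escape v∈Nᵂu (v∉Nᵂv v)))
        where
        v∈Nᵂu = ∩⁺ (N⁺-symmetric u∈) v∈W

    completeOn : CompleteOn W
    completeOn {u} {w} u∈W w∈W u≢w = ¬∉⇒∈ impossible
      where
      X = Nᵂ u ∪ ｛ u ｝
      1+a≤∣X∣ : suc a ≤ ∣ X ∣
      1+a≤∣X∣ = ≤-trans (s≤s (≤-trans (m≤m+n a b) (≤-trans (n≤1+n _) (n≤1+n _))))
                  (≤-reflexive (sym (trans (∣P∪｛x｝∣≡1+∣P∣ (v∉Nᵂv u)) (cong suc (outdeg u∈W)))))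
      disjoint : w ∉ N⁺ u → ∀ {z} → z ∈ Nᵂ w → z ∈ X → ⊥
      disjoint u↛w z∈Nᵂw z∈X with ∈P∪｛y｝⁻ z∈X
      ... | inj₂ z≡u = ∉⇒¬∈ u↛w (subst (_⟶ w) z≡u (N⁺-symmetric w∈W z∈Nᵂw))
      ... | inj₁ z∈Nᵂu = [ (λ w≡u → u≢w (sym w≡u)) , (λ w∈Nᵂu → ∉⇒¬∈ u↛w (∩⁻ w∈Nᵂu .proj₁)) ]′
                           (N⁺-closed u∈W z∈Nᵂu (∩⁺ (N⁺-symmetric w∈W z∈Nᵂw) w∈W))
      impossible : ¬ w ∉ N⁺ u
      impossible u↛w
        with ∃-between (｛｝-⊆ (y∈P∪｛y｝ u)) (∣｛x｝∣≤ (s≤s z≤n)) 1+a≤∣X∣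
      ... | T , ｛u｝⊆T , T⊆X , ∣T∣
        with ∃∈ (≤-trans (s≤s z≤n) (≤-reflexive (sym (LikingOn-∪｛｝ liking T⊆W w∈W w∉T ∣T∣))))
        where
        T⊆W : T ⊆ W
        T⊆W y y∈T with ∈P∪｛y｝⁻ (T⊆X y y∈T)
        ... | inj₁ y∈Nᵂu = ∩⁻ y∈Nᵂu .proj₂
        ... | inj₂ refl = u∈W
        w∉T : w ∉ T
        w∉T = ¬∈⇒∉ λ w∈T → [ (λ w∈Nᵂu → ∉⇒¬∈ u↛w (∩⁻ w∈Nᵂu .proj₁)) , u≢w ∘ sym ]′
                                (∈P∪｛y｝⁻ (T⊆X w w∈T))
      ... | z , z∈ = disjoint u↛w (∩⁺ (common⁺⁻ (∩⁻ z∈ .proj₁) (y∈P∪｛y｝ w)) (∩⁻ z∈ .proj₂))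
                       (∪⁺ˡ (∩⁺ (common⁺⁻ (∩⁻ z∈ .proj₁) (∪⁺ˡ (｛u｝⊆T u (x∈｛x｝ u)))) (∩⁻ z∈ .proj₂)))

  module LikingPair {W : VSet} {a b : ℕ}
    (liking  : LikingOn W (3 + a) (1 + b))
    (liking⁻ : LikingOn W (2 + a) (2 + b))
    (2+a≤∣W∣ : 2 + a ≤ ∣ W ∣) where

    Cᵂ : VSet → VSet
    Cᵂ R = common⁺ R ∩ W

    Cᵂ-∉ : ∀ {R x} → x ∈ Cᵂ R → x ∉ R
    Cᵂ-∉ x∈ = common⁺-∉ (∩⁻ x∈ .proj₁)

    2≤∣Cᵂ∣ : ∀ {R} → R ⊆ W → ∣ R ∣ ≡ 2 + a → 2 ≤ ∣ Cᵂ R ∣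
    2≤∣Cᵂ∣ {R} R⊆W ∣R∣ = ≤-trans (s≤s (s≤s z≤n)) (≤-reflexive (sym (liking⁻ R R⊆W ∣R∣)))

    common-clique : ∀ {R c c′} → R ⊆ W → ∣ R ∣ ≡ 2 + a → c ∈ Cᵂ R → c′ ∈ Cᵂ R → c′ ≢ c → c ⟶ c′
    common-clique {R} {c} {c′} R⊆W ∣R∣ c∈ c′∈ c′≢c =
      common⁺⁻ (∩⁻ (⊆∧∣∣≥⇒⊇ shrinks same-size c′ (-⁺ c′∈ c′≢c)) .proj₁) (y∈P∪｛y｝ c)
      where
      shrinks : Cᵂ (R ∪ ｛ c ｝) ⊆ Cᵂ R - c
      shrinks z z∈ = let (z∈common , z∈W) = ∩⁻ z∈ in
        -⁺ (∩⁺ (common⁺-antitone ⊆-∪ˡ z z∈common) z∈W)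
           (λ { refl → ∉⇒¬∈ (common⁺-∉ z∈common) (y∈P∪｛y｝ z) })
      same-size : ∣ Cᵂ R - c ∣ ≤ ∣ Cᵂ (R ∪ ｛ c ｝) ∣
      same-size = ≤-reflexive (trans (suc-injective (trans (sym (∣P∣≡1+∣P-x∣ c∈)) (liking⁻ R R⊆W ∣R∣)))
                    (sym (LikingOn-∪｛｝ liking R⊆W (∩⁻ c∈ .proj₂) (Cᵂ-∉ c∈) ∣R∣)))

    module Exchange {R : VSet} (R⊆W : R ⊆ W) (∣R∣ : ∣ R ∣ ≡ 2 + a) {r : Vertex} (r∈R : r ∈ R)
                    {c c₂ : Vertex} (c∈ : c ∈ Cᵂ R) (c₂∈ : c₂ ∈ Cᵂ R) (c₂≢c : c₂ ≢ c) where

      R′ : VSet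
      R′ = R - r

      R′⊆R : R′ ⊆ R
      R′⊆R x x∈ = -⁻ x∈ .proj₁

      ∣R′∣ : ∣ R′ ∣ ≡ 1 + a
      ∣R′∣ = suc-injective (trans (sym (∣P∣≡1+∣P-x∣ r∈R)) ∣R∣)

      R′∪x⊆W : ∀ {x} → x ∈ Cᵂ R → R′ ∪ ｛ x ｝ ⊆ W
      R′∪x⊆W x∈ = ∪｛｝-⊆ (λ y y∈ → R⊆W y (R′⊆R y y∈)) (∩⁻ x∈ .proj₂)

      x∉R′ : ∀ {x} → x ∈ Cᵂ R → x ∉ R′
      x∉R′ x∈ = ⊆-∉ R′⊆R (Cᵂ-∉ x∈)

      ∣R′∪x∣ : ∀ {x} → x ∈ Cᵂ R → ∣ R′ ∪ ｛ x ｝ ∣ ≡ 2 + a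
      ∣R′∪x∣ x∈ = trans (∣P∪｛x｝∣≡1+∣P∣ (x∉R′ x∈)) (cong suc ∣R′∣)

      exchange : ∀ {x} → x ∈ Cᵂ R → Cᵂ R - x ⊆ Cᵂ (R′ ∪ ｛ x ｝)
      exchange {x} x∈ z z∈ = let (z∈Cᵂ , z≢x) = -⁻ z∈ in
        ∩⁺ (common⁺⁺ λ s s∈ → [ (λ s∈R′ → common⁺⁻ (∩⁻ z∈Cᵂ .proj₁) (R′⊆R s s∈R′))
                               , (λ { refl → common-clique R⊆W ∣R∣ x∈ z∈Cᵂ z≢x }) ]′ (∈P∪｛y｝⁻ s∈))
           (∩⁻ z∈Cᵂ .proj₂)

      S : VSet
      S = R′ ∪ ｛ c ｝ ∪ ｛ c₂ ｝

      ∣S∣ : ∣ S ∣ ≡ 3 + a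
      ∣S∣ = trans (∣P∪｛x｝∣≡1+∣P∣ (∉P∪｛y｝ (x∉R′ c₂∈) c₂≢c)) (cong suc (∣R′∪x∣ c∈))

      ∣Cᵂ-c-c₂∣ : ∣ Cᵂ R - c - c₂ ∣ ≡ b
      ∣Cᵂ-c-c₂∣ = suc-injective (suc-injective (begin
        2 + ∣ Cᵂ R - c - c₂ ∣ ≡⟨ cong suc (sym (∣P∣≡1+∣P-x∣ (-⁺ c₂∈ c₂≢c))) ⟩
        1 + ∣ Cᵂ R - c ∣      ≡⟨ sym (∣P∣≡1+∣P-x∣ c∈) ⟩
        ∣ Cᵂ R ∣              ≡⟨ liking⁻ R R⊆W ∣R∣ ⟩
        2 + b                 ∎))
        where open ≡-Reasoning

      S⊆W : S ⊆ W
      S⊆W = ∪｛｝-⊆ (R′∪x⊆W c∈) (∩⁻ c₂∈ .proj₂)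

      -- A common out-neighbour of S outside Cᵂ R - c - c₂ dominates all of Cᵂ R, which forces it
      -- into R, and then to be r.
      module Outsider {y : Vertex} (y∈Cᵂ[S] : y ∈ Cᵂ S) (y∉ : y ∉ Cᵂ R - c - c₂) where

        y∉S : y ∉ S
        y∉S = Cᵂ-∉ y∈Cᵂ[S]

        y∉Cᵂ : y ∉ Cᵂ R
        y∉Cᵂ = ¬∈⇒∉ λ y∈Cᵂ → ∉⇒¬∈ y∉ (-⁺ (-⁺ y∈Cᵂ y≢c) y≢c₂)
          where
          y≢c : y ≢ c
          y≢c refl = ∉⇒¬∈ y∉S (∪⁺ˡ (y∈P∪｛y｝ c))
          y≢c₂ : y ≢ c₂
          y≢c₂ refl = ∉⇒¬∈ y∉S (y∈P∪｛y｝ c₂)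

        y∈Cᵂ[R′∪c] : y ∈ Cᵂ (R′ ∪ ｛ c ｝)
        y∈Cᵂ[R′∪c] = ∩⁺ (common⁺-antitone ⊆-∪ˡ y (∩⁻ y∈Cᵂ[S] .proj₁)) (∩⁻ y∈Cᵂ[S] .proj₂)

        y∈Cᵂ[R′∪c₂] : y ∈ Cᵂ (R′ ∪ ｛ c₂ ｝)
        y∈Cᵂ[R′∪c₂] = ∩⁺ (common⁺-antitone R′∪c₂⊆S y (∩⁻ y∈Cᵂ[S] .proj₁)) (∩⁻ y∈Cᵂ[S] .proj₂)
          where
          R′∪c₂⊆S : R′ ∪ ｛ c₂ ｝ ⊆ S
          R′∪c₂⊆S = ∪｛｝-⊆ (λ z z∈ → ∪⁺ˡ (∪⁺ˡ z∈)) (y∈P∪｛y｝ c₂)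

        y⟶ : ∀ {x z} → x ∈ Cᵂ R → y ∈ Cᵂ (R′ ∪ ｛ x ｝) → z ∈ Cᵂ R → z ≢ x → y ⟶ z
        y⟶ {x} {z} x∈ y∈ z∈ z≢x = common-clique (R′∪x⊆W x∈) (∣R′∪x∣ x∈) y∈ (exchange x∈ z (-⁺ z∈ z≢x))
                                    λ { refl → ∉⇒¬∈ y∉Cᵂ z∈ }

        y⟶Cᵂ : ∀ {z} → z ∈ Cᵂ R → y ⟶ z
        y⟶Cᵂ {z} z∈ with z ≟ c
        ... | no  z≢c  = y⟶ c∈ y∈Cᵂ[R′∪c] z∈ z≢c
        ... | yes refl = y⟶ c₂∈ y∈Cᵂ[R′∪c₂] z∈ (c₂≢c ∘ sym)

        y∈R : y ∈ R
        y∈R = ¬∉⇒∈ λ y∉R → 1+n≰n (begin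
          2 + b                  ≡⟨ sym (liking⁻ R R⊆W ∣R∣) ⟩
          ∣ Cᵂ R ∣               ≤⟨ ∣∣-mono (Cᵂ⊆ y∉R) ⟩
          ∣ Cᵂ (R ∪ ｛ y ｝) ∣   ≡⟨ LikingOn-∪｛｝ liking R⊆W (∩⁻ y∈Cᵂ[S] .proj₂) y∉R ∣R∣ ⟩
          1 + b                  ∎)
          where
          open ≤-Reasoning
          Cᵂ⊆ : y ∉ R → Cᵂ R ⊆ Cᵂ (R ∪ ｛ y ｝)
          Cᵂ⊆ _ z z∈ = ∩⁺ (common⁺-∪｛｝ (∩⁻ z∈ .proj₁) (y⟶Cᵂ z∈)) (∩⁻ z∈ .proj₂)

        y≡r : y ≡ r
        y≡r with y ≟ r
        ... | yes y≡r = y≡r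
        ... | no  y≢r = ⊥-elim (∉⇒¬∈ (Cᵂ-∉ y∈Cᵂ[R′∪c]) (∪⁺ˡ (-⁺ y∈R y≢r)))

      r∈Cᵂ[R′∪c] : r ∈ Cᵂ (R′ ∪ ｛ c ｝)
      r∈Cᵂ[R′∪c] with ∃∈─ {P = Cᵂ R - c - c₂} {Q = Cᵂ S}
                          (≤-reflexive (trans (cong suc ∣Cᵂ-c-c₂∣) (sym (liking S S⊆W ∣S∣))))
      ... | y , y∈Cᵂ[S] , y∉ = subst (_∈ Cᵂ (R′ ∪ ｛ c ｝)) y≡r y∈Cᵂ[R′∪c]
        where open Outsider y∈Cᵂ[S] y∉

    set-clique : ∀ {R r u} → R ⊆ W → ∣ R ∣ ≡ 2 + a → r ∈ R → u ∈ R → u ≢ r → u ⟶ r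
    set-clique {R} R⊆W ∣R∣ r∈R u∈R u≢r with ∃∈ (≤-trans (s≤s z≤n) (2≤∣Cᵂ∣ R⊆W ∣R∣))
    ... | c , c∈ with ∃∈-≢ (2≤∣Cᵂ∣ R⊆W ∣R∣) c
    ... | c₂ , c₂∈ , c₂≢c =
      common⁺⁻ (∩⁻ (Exchange.r∈Cᵂ[R′∪c] R⊆W ∣R∣ r∈R c∈ c₂∈ c₂≢c) .proj₁) (∪⁺ˡ (-⁺ u∈R u≢r))

    completeOn : CompleteOn W
    completeOn {u} {w} u∈W w∈W u≢w with ∃-between (｛x｝∪｛y｝⊆ u∈W w∈W) ∣pair∣≤2+a 2+a≤∣W∣
      where
      ∣pair∣≤2+a = ≤-trans (≤-reflexive (∣｛x｝∪｛y｝∣≡2 u≢w)) (s≤s (s≤s z≤n))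
    ... | R , pair⊆R , R⊆W , ∣R∣ =
      set-clique R⊆W ∣R∣ (pair⊆R w (y∈P∪｛y｝ w)) (pair⊆R u (∪⁺ˡ (x∈｛x｝ u))) u≢w

  module LikingPair₀ {W : VSet} {a : ℕ}
    (liking  : LikingOn W (3 + a) 0)
    (liking⁻ : LikingOn W (2 + a) 1)
    (2+a≤∣W∣ : 2 + a ≤ ∣ W ∣) where

    -- Each w ∈ W ─ P has exactly one common out-neighbour c of P ∪ {w} in W, and each such c
    -- arises from at most one w, so there are at least as many common out-neighbours of P as
    -- vertices in W ─ P.
    W─P⊆common : ∀ {P} → P ⊆ W → ∣ P ∣ ≡ 1 + a → W ─ P ⊆ common⁺ P ∩ W
    W─P⊆common {P} P⊆W ∣P∣ = ⊆∧∣∣≥⇒⊇ common⊆W─P (begin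
      ∣ W ─ P ∣                ≡⟨ sym (*-identityʳ _) ⟩
      ∣ W ─ P ∣ * 1            ≡⟨ sym (∑-indicator rows rows-outside) ⟩
      ∑[ w < _ ] ∣ G w ∣       ≡⟨ ∑∣∣ᵀ G ⟩
      ∑[ c < _ ] ∣ (G ᵀ) c ∣   ≤⟨ ∑-indicator-≤ columns columns-outside ⟩
      ∣ common⁺ P ∩ W ∣ * 1    ≡⟨ *-identityʳ _ ⟩
      ∣ common⁺ P ∩ W ∣        ∎)
      where
      open ≤-Reasoning
      common⊆W─P : common⁺ P ∩ W ⊆ W ─ P
      common⊆W─P c c∈ = ─⁺ (∩⁻ c∈ .proj₂) (common⁺-∉ (∩⁻ c∈ .proj₁))
      G : Vertex → VSet
      G = (W ─ P) ◃ λ w → common⁺ (P ∪ ｛ w ｝) ∩ W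
      rows : ∀ w → w ∈ W ─ P → ∣ G w ∣ ≡ 1
      rows w w∈ = trans (∣∣-cong (λ c c∈ → ∈◃⁻ c∈ .proj₂) (λ c c∈ → ∈◃⁺ w∈ c∈))
                    (LikingOn-∪｛｝ liking⁻ P⊆W (─⁻ w∈ .proj₁) (─⁻ w∈ .proj₂) ∣P∣)
      rows-outside : ∀ w → w ∉ W ─ P → ∣ G w ∣ ≡ 0
      rows-outside w w∉ = ∣∣-empty λ c c∈ → ∉⇒¬∈ w∉ (∈◃⁻ c∈ .proj₁)
      columns : ∀ c → c ∈ common⁺ P ∩ W → ∣ (G ᵀ) c ∣ ≤ 1
      columns c _ = ≡⇒∣∣≤1 unique
        where
        unique : ∀ {w w′} → w ∈ (G ᵀ) c → w′ ∈ (G ᵀ) c → w ≡ w′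
        unique {w} {w′} w∈ w′∈ with w ≟ w′ | ∈◃⁻ (∈ᵀ⁻ w∈) | ∈◃⁻ (∈ᵀ⁻ w′∈)
        ... | yes w≡w′ | _ | _ = w≡w′
        ... | no  w≢w′ | w∈W─P , c∈Cw | w′∈W─P , c∈Cw′ = ⊥-elim (∉⇒¬∈ (∣∣≡0⇒∉ ∣C∣≡0 c) c∈C)
          where
          ∣C∣≡0 = LikingOn-∪｛｝ liking (∪｛｝-⊆ P⊆W (─⁻ w∈W─P .proj₁)) (─⁻ w′∈W─P .proj₁)
                    (∉P∪｛y｝ (─⁻ w′∈W─P .proj₂) (w≢w′ ∘ sym))
                    (trans (∣P∪｛x｝∣≡1+∣P∣ (─⁻ w∈W─P .proj₂)) (cong suc ∣P∣))
          c∈C = ∩⁺ (common⁺-∪｛｝ (∩⁻ c∈Cw .proj₁) (common⁺⁻ (∩⁻ c∈Cw′ .proj₁) (y∈P∪｛y｝ w′)))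
                   (∩⁻ c∈Cw .proj₂)
      columns-outside : ∀ c → c ∉ common⁺ P ∩ W → ∣ (G ᵀ) c ∣ ≡ 0
      columns-outside c c∉ = ∣∣-empty λ w w∈ → let c∈Cw = ∈◃⁻ (∈ᵀ⁻ w∈) .proj₂ in
        ∉⇒¬∈ c∉ (∩⁺ (common⁺-antitone ⊆-∪ˡ c (∩⁻ c∈Cw .proj₁)) (∩⁻ c∈Cw .proj₂))

    completeOn : CompleteOn W
    completeOn {u} {x} u∈W x∈W u≢x with ∃-between (｛｝-⊆ (-⁺ u∈W u≢x)) ∣｛u｝∣≤1+a 1+a≤∣W-x∣
      where
      ∣｛u｝∣≤1+a = ∣｛x｝∣≤ (s≤s z≤n)
      1+a≤∣W-x∣ = s≤s⁻¹ (≤-trans 2+a≤∣W∣ (≤-reflexive (∣P∣≡1+∣P-x∣ x∈W)))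
    ... | P , ｛u｝⊆P , P⊆W-x , ∣P∣ =
      common⁺⁻ (∩⁻ (W─P⊆common P⊆W ∣P∣ x (─⁺ x∈W x∉P)) .proj₁) (｛u｝⊆P u (x∈｛x｝ u))
      where
      P⊆W : P ⊆ W
      P⊆W y y∈ = -⁻ (P⊆W-x y y∈) .proj₁
      x∉P : x ∉ P
      x∉P = ⊆-∉ P⊆W-x (x∉P-x x)

  LikingOn-pair⇒CompleteOn : ∀ {W s μ} → LikingOn W (suc s) μ → LikingOn W s (suc μ) →
                             1 ≤ s → s ≤ ∣ W ∣ → ¬ (s ≡ 1 × μ ≡ 0) → CompleteOn W
  LikingOn-pair⇒CompleteOn {s = 0}                       _      _       ()  _      _
  LikingOn-pair⇒CompleteOn {s = 1}           {μ = 0}     _      _       _   _      excluded =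
    ⊥-elim (excluded (refl , refl))
  LikingOn-pair⇒CompleteOn {s = 1}           {μ = suc b} liking liking⁻ _   _      _ =
    OutRegular.completeOn {a = 0} liking (LikingOn-1⇒outdeg liking⁻)
  LikingOn-pair⇒CompleteOn {s = suc (suc a)} {μ = 0}     liking liking⁻ _   s≤∣W∣ _ =
    LikingPair₀.completeOn liking liking⁻ s≤∣W∣
  LikingOn-pair⇒CompleteOn {s = suc (suc a)} {μ = suc b} liking liking⁻ _   s≤∣W∣ _ =
    LikingPair.completeOn liking liking⁻ s≤∣W∣

  module UniversalVertex {v : Vertex} (v⟶ : ∀ {w} → w ≢ v → v ⟶ w) {s μ : ℕ}
    (liking : LikingOn full (suc s) (suc μ)) (1≤s : 1 ≤ s) (s<n : suc s ≤ size D) where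

    W : VSet
    W = full - v

    ∈W : ∀ {u} → u ≢ v → u ∈ W
    ∈W u≢v = -⁺ x∈full u≢v

    v∉W : v ∉ W
    v∉W = x∉P-x v

    s≤∣W∣ : s ≤ ∣ W ∣
    s≤∣W∣ = s≤s⁻¹ (≤-trans s<n (≤-reflexive (trans (sym ∣full∣≡n) (∣P∣≡1+∣P-x∣ x∈full))))

    ∣P∪v∣ : ∀ {P m} → P ⊆ W → ∣ P ∣ ≡ m → ∣ P ∪ ｛ v ｝ ∣ ≡ suc m
    ∣P∪v∣ P⊆W ∣P∣ = trans (∣P∪｛x｝∣≡1+∣P∣ (⊆-∉ P⊆W v∉W)) (cong suc ∣P∣)

    ⟶v : ∀ {u} → u ≢ v → u ⟶ v
    ⟶v {u} u≢v = ¬∉⇒∈ impossible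
      where
      impossible : ¬ v ∉ N⁺ u
      impossible u↛v with ∃-between (｛｝-⊆ (∈W u≢v)) (∣｛x｝∣≤ 1≤s) s≤∣W∣
      ... | T , ｛u｝⊆T , T⊆W , ∣T∣ with ∃∈ (≤-trans (s≤s z≤n) (≤-reflexive (sym ∣common⁺[T∪v]∣)))
        where
        ∣common⁺[T∪v]∣ = ∣common⁺∣-full liking (∣P∪v∣ T⊆W ∣T∣)
      ... | c , c∈ = 1+n≰n (begin
        suc μ                            ≡⟨ sym (∣common⁺∣-full liking ∣T∪c∣) ⟩
        ∣ common⁺ (T ∪ ｛ c ｝) ∣        ≤⟨ ∣∣-mono shrinks ⟩
        ∣ common⁺ (T ∪ ｛ v ｝) - c ∣    ≡⟨ suc-injective (trans (sym (∣P∣≡1+∣P-x∣ c∈))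
                                                               (∣common⁺∣-full liking (∣P∪v∣ T⊆W ∣T∣))) ⟩
        μ                                ∎)
        where
        open ≤-Reasoning
        ∣T∪c∣ = trans (∣P∪｛x｝∣≡1+∣P∣ (⊆-∉ ⊆-∪ˡ (common⁺-∉ c∈))) (cong suc ∣T∣)
        shrinks : common⁺ (T ∪ ｛ c ｝) ⊆ common⁺ (T ∪ ｛ v ｝) - c
        shrinks z z∈ = -⁺ (common⁺-∪｛｝ z∈common⁺T (v⟶ z≢v)) (⟶-irrefl (common⁺⁻ z∈ (y∈P∪｛y｝ c)) ∘ sym)
          where
          z∈common⁺T = common⁺-antitone ⊆-∪ˡ z z∈
          z≢v : z ≢ v
          z≢v refl = ∉⇒¬∈ u↛v (common⁺⁻ z∈common⁺T (｛u｝⊆T u (x∈｛x｝ u)))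

    liking-W : LikingOn W (suc s) μ
    liking-W P P⊆W ∣P∣ = ∣common⁺∩full-x∣ (common⁺⁺ λ u u∈P → ⟶v (-⁻ (P⊆W u u∈P) .proj₂))
                                         (∣common⁺∣-full liking ∣P∣)

    liking⁻-W : LikingOn W s (suc μ)
    liking⁻-W P P⊆W ∣P∣ = trans (∣∣-cong ⊆common⁺[P∪v] common⁺[P∪v]⊆) (∣common⁺∣-full liking (∣P∪v∣ P⊆W ∣P∣))
      where
      ⊆common⁺[P∪v] : common⁺ P ∩ W ⊆ common⁺ (P ∪ ｛ v ｝)
      ⊆common⁺[P∪v] z z∈ = common⁺-∪｛｝ (∩⁻ z∈ .proj₁) (v⟶ (-⁻ (∩⁻ z∈ .proj₂) .proj₂))
      common⁺[P∪v]⊆ : common⁺ (P ∪ ｛ v ｝) ⊆ common⁺ P ∩ W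
      common⁺[P∪v]⊆ z z∈ = ∩⁺ (common⁺-antitone ⊆-∪ˡ z z∈)
                              (∈W (⟶-irrefl (common⁺⁻ z∈ (y∈P∪｛y｝ v)) ∘ sym))

    completeOn : ¬ (s ≡ 1 × μ ≡ 0) → CompleteOn full
    completeOn excluded {u} {w} _ _ u≢w with u ≟ v | w ≟ v
    ... | yes refl | _        = v⟶ (u≢w ∘ sym)
    ... | no  u≢v  | yes refl = ⟶v u≢v
    ... | no  u≢v  | no  w≢v  =
      LikingOn-pair⇒CompleteOn liking-W liking⁻-W 1≤s s≤∣W∣ excluded (∈W u≢v) (∈W w≢v) u≢w

  -- Complete digraphs

  Complete : Set
  Complete = CompleteOn full

  ∣full-v∣ : ∀ v → ∣ full - v ∣ ≡ size D ∸ 1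
  ∣full-v∣ v = cong (_∸ 1) (trans (sym (∣P∣≡1+∣P-x∣ {P = full} x∈full)) (∣full∣≡n {size D}))

  Complete⇒∣N⁺∣ : Complete → ∀ v → ∣ N⁺ v ∣ ≡ size D ∸ 1
  Complete⇒∣N⁺∣ complete v = trans (∣∣-cong (λ w v⟶w → -⁺ {P = full} x∈full (⟶-irrefl v⟶w ∘ sym))
                                          (λ w w∈ → complete x∈full x∈full (-⁻ w∈ .proj₂ ∘ sym)))
                                    (∣full-v∣ v)

  Complete⇒∣N⁻∣ : Complete → ∀ v → ∣ N⁻ v ∣ ≡ size D ∸ 1
  Complete⇒∣N⁻∣ complete v = trans (∣∣-cong (λ u u∈ → -⁺ {P = full} x∈full (⟶-irrefl (∈N⁻⇒⟶ u∈)))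
                                          (λ u u∈ → ⟶⇒∈N⁻ (complete x∈full x∈full (-⁻ u∈ .proj₂))))
                                    (∣full-v∣ v)

  Complete⇒∣common⁺∣ : Complete → ∀ {P} → 0 < ∣ P ∣ → ∣ P ∣ + ∣ common⁺ P ∩ full ∣ ≡ size D
  Complete⇒∣common⁺∣ complete {P} 0<∣P∣ = begin
    ∣ P ∣ + ∣ common⁺ P ∩ full ∣ ≡⟨ cong (∣ P ∣ +_) (∣∣-cong common⁺⊆ ⊆common⁺) ⟩
    ∣ P ∣ + ∣ full ─ P ∣         ≡⟨ sym (∣P∣≡∣Q∣+∣P─Q∣ (λ _ _ → x∈full)) ⟩
    ∣ full ∣                     ≡⟨ ∣full∣≡n ⟩
    size D                       ∎
    where
    open ≡-Reasoning
    common⁺⊆ : common⁺ P ∩ full ⊆ full ─ P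
    common⁺⊆ w w∈ = ─⁺ x∈full (common⁺-∉ (∩⁻ w∈ .proj₁))
    ⊆common⁺ : full ─ P ⊆ common⁺ P ∩ full
    ⊆common⁺ w w∈ = ∩⁺ (common⁺⁺ λ u u∈P → complete x∈full x∈full λ { refl → ∉⇒¬∈ (─⁻ w∈ .proj₂) u∈P })
                       x∈full

  Complete⇒LikingOn : Complete → ∀ {s} → 1 ≤ s → LikingOn full s (size D ∸ s)
  Complete⇒LikingOn complete {s} 1≤s P _ ∣P∣ = begin
    ∣ common⁺ P ∩ full ∣                 ≡⟨ sym (m+n∸m≡n ∣ P ∣ _) ⟩
    ∣ P ∣ + ∣ common⁺ P ∩ full ∣ ∸ ∣ P ∣ ≡⟨ cong₂ _∸_ (Complete⇒∣common⁺∣ complete 0<∣P∣) ∣P∣ ⟩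
    size D ∸ s                           ∎
    where
    open ≡-Reasoning
    0<∣P∣ = ≤-trans 1≤s (≤-reflexive (sym ∣P∣))

  Complete⇒size : Complete → ∀ {s μ} → 1 ≤ s → s ≤ size D → LikingOn full s μ → size D ≡ s + μ
  Complete⇒size complete {s} {μ} 1≤s s≤n liking with ∃-subset {P = full} (≤-trans s≤n (≤-reflexive (sym ∣full∣≡n)))
  ... | P , _ , ∣P∣ = begin
    size D                        ≡⟨ sym (Complete⇒∣common⁺∣ complete (≤-trans 1≤s (≤-reflexive (sym ∣P∣)))) ⟩
    ∣ P ∣ + ∣ common⁺ P ∩ full ∣  ≡⟨ cong₂ _+_ ∣P∣ (liking P (λ _ _ → x∈full) ∣P∣) ⟩
    s + μ                         ∎
    where open ≡-Reasoning

  outdeg≡∣N⁺∣ : ∀ v → outdeg D v ≡ ∣ N⁺ v ∣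
  outdeg≡∣N⁺∣ v = ∣tabulate∣ (N⁺ v)

  indeg≡∣N⁻∣ : ∀ v → indeg D v ≡ ∣ N⁻ v ∣
  indeg≡∣N⁻∣ v = ∣tabulate∣ (N⁻ v)

  opaque
    unfolding common⁺ _∈_ ｛_｝

    Liking⇒LikingOn : ∀ {s μ} → Liking s μ D → LikingOn full s μ
    Liking⇒LikingOn (_ , liking) P _ ∣P∣ = trans (∣P∩full∣ (common⁺ P))
      (trans (sym (∣tabulate∣ (common⁺ P))) (liking (tabulate P) (trans (∣tabulate∣ P) ∣P∣)))

    LikingOn⇒Liking : ∀ {s μ} → s ≤ size D → LikingOn full s μ → Liking s μ D
    LikingOn⇒Liking {s} {μ} s≤n liking = s≤n , λ S →
      subst (λ S → Subset.∣ S ∣ ≡ s → Subset.∣ commonOut D S ∣ ≡ μ) (tabulate∘lookup S)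
        λ ∣S∣ → trans (∣tabulate∣ (common⁺ (lookup S)))
                  (trans (sym (∣P∩full∣ (common⁺ (lookup S))))
                    (liking (lookup S) (λ _ _ → refl) (trans (sym (∣tabulate∣ (lookup S))) ∣S∣)))

    outNbr≡∁⁅v⁆⇔ : ∀ v → outNbr D v ≡ ∁ ⁅ v ⁆ ⇔ (∀ {w} → w ≢ v → v ⟶ w)
    outNbr≡∁⁅v⁆⇔ v = mk⇔ universal complement
      where
      universal : outNbr D v ≡ ∁ ⁅ v ⁆ → ∀ {w} → w ≢ v → v ⟶ w
      universal eq {w} w≢v = begin
        arc D v w                 ≡⟨ sym (lookup∘tabulate (arc D v) w) ⟩
        lookup (outNbr D v) w     ≡⟨ cong (λ S → lookup S w) eq ⟩
        lookup (∁ ⁅ v ⁆) w        ≡⟨ lookup∁⁅v⁆ v w ⟩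
        not (｛ v ｝ w)           ≡⟨ cong not (≢⇒∉｛｝ w≢v) ⟩
        true                      ∎
        where open ≡-Reasoning
      complement : (∀ {w} → w ≢ v → v ⟶ w) → outNbr D v ≡ ∁ ⁅ v ⁆
      complement v⟶ = trans (tabulate-cong pointwise) (tabulate∘lookup (∁ ⁅ v ⁆))
        where
        pointwise : ∀ w → arc D v w ≡ lookup (∁ ⁅ v ⁆) w
        pointwise w with w ≟ v
        ... | yes refl = trans (loopless D v) (sym (trans (lookup∁⁅v⁆ v v) (cong not (x∈｛x｝ v))))
        ... | no  w≢v  = trans (v⟶ w≢v) (sym (trans (lookup∁⁅v⁆ v w) (cong not (≢⇒∉｛｝ w≢v))))

    Complete⇒Isomorphic : Complete → ∀ {m} → size D ≡ m → Isomorphic D (complete m)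
    Complete⇒Isomorphic complete′ refl = ↔-refl , arc≡
      where
      arc≡ : ∀ u w → arc D u w ≡ not ⌊ u ≟ w ⌋
      arc≡ u w with u ≟ w
      ... | yes refl = loopless D u
      ... | no  u≢w  = complete′ refl refl u≢w

    Isomorphic⇒Complete : ∀ {m} → Isomorphic D (complete m) → Complete × size D ≡ m
    Isomorphic⇒Complete (f , arc≡) = complete′ , ↔⇒≡ f
      where
      complete′ : Complete
      complete′ {u} {w} _ _ u≢w with Inverse.to f u ≟ Inverse.to f w in eq
      ... | yes fu≡fw = ⊥-elim (u≢w (Injection.injective (↔⇒↣ f) fu≡fw))
      ... | no  _     = trans (arc≡ u w) (cong (not ∘ ⌊_⌋) eq)

  -- Diregular liking digraphs

  -- Count the pairs (w, c) with w ∈ B ─ R, c a common out-neighbour of R in Y and w ⟶ c.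
  ∣common⁺∣-double-count : ∀ {B Y R : VSet} {s μ K} →
    (∀ S → S ⊆ B → ∣ S ∣ ≡ suc s → ∣ common⁺ S ∩ Y ∣ ≡ μ) →
    (∀ c → c ∈ Y → ∣ N⁻ c ∩ B ∣ ≡ K) →
    R ⊆ B → ∣ R ∣ ≡ s → ∣ common⁺ R ∩ Y ∣ * (K ∸ s) ≡ (∣ B ∣ ∸ s) * μ
  ∣common⁺∣-double-count {B} {Y} {R} {s} {μ} {K} liking in-degree R⊆B ∣R∣ = begin
    ∣ common⁺ R ∩ Y ∣ * (K ∸ s) ≡⟨ sym (∑-indicator columns columns-outside) ⟩
    ∑[ c < _ ] ∣ (G ᵀ) c ∣      ≡⟨ sym (∑∣∣ᵀ G) ⟩
    ∑[ w < _ ] ∣ G w ∣          ≡⟨ ∑-indicator rows rows-outside ⟩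
    ∣ B ─ R ∣ * μ               ≡⟨ cong (_* μ) (trans (∣P─Q∣≡∣P∣∸∣Q∣ R⊆B) (cong (∣ B ∣ ∸_) ∣R∣)) ⟩
    (∣ B ∣ ∸ s) * μ             ∎
    where
    open ≡-Reasoning
    G : Vertex → VSet
    G = (B ─ R) ◃ λ w → (common⁺ R ∩ Y) ∩ N⁺ w
    rows : ∀ w → w ∈ B ─ R → ∣ G w ∣ ≡ μ
    rows w w∈ = trans (∣∣-cong G⊆ ⊆G) (liking (R ∪ ｛ w ｝) (∪｛｝-⊆ R⊆B (─⁻ w∈ .proj₁))
                                      (trans (∣P∪｛x｝∣≡1+∣P∣ (─⁻ w∈ .proj₂)) (cong suc ∣R∣)))
      where
      G⊆ : G w ⊆ common⁺ (R ∪ ｛ w ｝) ∩ Y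
      G⊆ c c∈ = let (c∈C , w⟶c) = ∩⁻ (∈◃⁻ c∈ .proj₂) in
        ∩⁺ (common⁺-∪｛｝ (∩⁻ c∈C .proj₁) w⟶c) (∩⁻ c∈C .proj₂)
      ⊆G : common⁺ (R ∪ ｛ w ｝) ∩ Y ⊆ G w
      ⊆G c c∈ = let (c∈common , c∈Y) = ∩⁻ c∈ in
        ∈◃⁺ w∈ (∩⁺ (∩⁺ (common⁺-antitone ⊆-∪ˡ c c∈common) c∈Y) (common⁺⁻ c∈common (y∈P∪｛y｝ w)))
    rows-outside : ∀ w → w ∉ B ─ R → ∣ G w ∣ ≡ 0
    rows-outside w w∉ = ∣∣-empty λ c c∈ → ∉⇒¬∈ w∉ (∈◃⁻ c∈ .proj₁)
    columns : ∀ c → c ∈ common⁺ R ∩ Y → ∣ (G ᵀ) c ∣ ≡ K ∸ s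
    columns c c∈ = trans (∣∣-cong Gᵀ⊆ ⊆Gᵀ)
      (trans (∣P─Q∣≡∣P∣∸∣Q∣ R⊆N⁻c∩B) (cong₂ _∸_ (in-degree c (∩⁻ c∈ .proj₂)) ∣R∣))
      where
      R⊆N⁻c∩B : R ⊆ N⁻ c ∩ B
      R⊆N⁻c∩B r r∈R = ∩⁺ (⟶⇒∈N⁻ (common⁺⁻ (∩⁻ c∈ .proj₁) r∈R)) (R⊆B r r∈R)
      Gᵀ⊆ : (G ᵀ) c ⊆ (N⁻ c ∩ B) ─ R
      Gᵀ⊆ w w∈ = let (w∈B─R , c∈) = ∈◃⁻ (∈ᵀ⁻ w∈) in
        ─⁺ (∩⁺ (⟶⇒∈N⁻ (∩⁻ c∈ .proj₂)) (─⁻ w∈B─R .proj₁)) (─⁻ w∈B─R .proj₂)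
      ⊆Gᵀ : (N⁻ c ∩ B) ─ R ⊆ (G ᵀ) c
      ⊆Gᵀ w w∈ = let (w∈N⁻c∩B , w∉R) = ─⁻ w∈ in
        ∈ᵀ⁺ (∈◃⁺ (─⁺ (∩⁻ w∈N⁻c∩B .proj₂) w∉R) (∩⁺ c∈ (∈N⁻⇒⟶ (∩⁻ w∈N⁻c∩B .proj₁))))
    columns-outside : ∀ c → c ∉ common⁺ R ∩ Y → ∣ (G ᵀ) c ∣ ≡ 0
    columns-outside c c∉ = ∣∣-empty λ w w∈ → ∉⇒¬∈ c∉ (∩⁻ (∈◃⁻ (∈ᵀ⁻ w∈) .proj₂) .proj₁)

  module Descent {k : ℕ} (indeg : ∀ v → ∣ N⁻ v ∣ ≡ k) {s μ : ℕ}
    (liking : LikingOn full (suc s) μ) (1≤μ : 1 ≤ μ) (s<n : suc s ≤ size D) where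

    s<∣full∣ : suc s ≤ ∣ full {size D} ∣
    s<∣full∣ = ≤-trans s<n (≤-reflexive (sym ∣full∣≡n))

    double-count : ∀ {R} → ∣ R ∣ ≡ s → ∣ common⁺ R ∩ full ∣ * (k ∸ s) ≡ (size D ∸ s) * μ
    double-count ∣R∣ = trans
      (∣common⁺∣-double-count (λ S _ → liking S (λ _ _ → x∈full)) (λ c _ → trans (∣P∩full∣ (N⁻ c)) (indeg c))
                              (λ _ _ → x∈full) ∣R∣)
      (cong (λ m → (m ∸ s) * μ) ∣full∣≡n)

    s<k : suc s ≤ k
    s<k with ∃-subset {P = full} s<∣full∣
    ... | S , _ , ∣S∣ with ∃∈ (≤-trans 1≤μ (≤-reflexive (sym (∣common⁺∣-full liking ∣S∣))))
    ... | c , c∈ = begin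
      suc s      ≡⟨ sym ∣S∣ ⟩
      ∣ S ∣      ≤⟨ ∣∣-mono (λ u u∈S → ⟶⇒∈N⁻ (common⁺⁻ c∈ u∈S)) ⟩
      ∣ N⁻ c ∣   ≡⟨ indeg c ⟩
      k          ∎
      where open ≤-Reasoning

    liking-descends : ∃[ μ′ ] LikingOn full s μ′ × μ′ * (k ∸ s) ≡ (size D ∸ s) * μ × 1 ≤ μ′ × suc s ≤ k
    liking-descends with ∃-subset {P = full} (≤-trans (n≤1+n s) s<∣full∣)
    ... | R₀ , _ , ∣R₀∣ = ∣ common⁺ R₀ ∩ full ∣ , liking′ , double-count ∣R₀∣ , 1≤μ′ , s<k
      where
      liking′ : LikingOn full s ∣ common⁺ R₀ ∩ full ∣
      liking′ R _ ∣R∣ = *-cancelʳ-≡ _ _ (k ∸ s) {{>-nonZero (m<n⇒0<n∸m s<k)}}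
                          (trans (double-count ∣R∣) (sym (double-count ∣R₀∣)))
      1≤μ′ : 1 ≤ ∣ common⁺ R₀ ∩ full ∣
      1≤μ′ with ∃∈─ {P = R₀} {Q = full} (≤-trans (≤-reflexive (cong suc ∣R₀∣)) s<∣full∣)
      ... | w , _ , w∉R₀ = begin
        1                                ≤⟨ 1≤μ ⟩
        μ                                ≡⟨ sym (LikingOn-∪｛｝ liking (λ _ _ → x∈full) x∈full w∉R₀ ∣R₀∣) ⟩
        ∣ common⁺ (R₀ ∪ ｛ w ｝) ∩ full ∣ ≤⟨ ∣∣-mono (λ z z∈ → ∩⁺ (common⁺-antitone ⊆-∪ˡ z (∩⁻ z∈ .proj₁)) x∈full) ⟩
        ∣ common⁺ R₀ ∩ full ∣            ∎
        where open ≤-Reasoning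

  open Descent using (liking-descends)

  liking-descends-to-3 : ∀ {k} → (∀ v → ∣ N⁻ v ∣ ≡ k) → ∀ j {μ} → LikingOn full (3 + j) μ → 1 ≤ μ → 3 + j ≤ size D →
    ∃[ β ] LikingOn full 3 β × 1 ≤ β
  liking-descends-to-3 indeg zero    {μ} liking 1≤μ _   = μ , liking , 1≤μ
  liking-descends-to-3 indeg (suc j)     liking 1≤μ t≤n =
    let (_ , liking′ , _ , 1≤μ′ , _) = liking-descends indeg liking 1≤μ t≤n
    in liking-descends-to-3 indeg j liking′ 1≤μ′ (≤-trans (n≤1+n _) t≤n)

  module Diregular {k : ℕ} (outdeg : ∀ v → ∣ N⁺ v ∣ ≡ k) (indeg : ∀ v → ∣ N⁻ v ∣ ≡ k) where

    module CommonInNeighbours {α : ℕ} (liking₂ : LikingOn full 2 α) (1≤k : 1 ≤ k)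
      (k[k-1]≡[n-1]α : k * (k ∸ 1) ≡ (size D ∸ 1) * α) (x : Vertex) where

      Λ : Vertex → VSet
      Λ y = N⁻ x ∩ N⁻ y

      ∑∣Λ∣≡k*k : ∑[ y < size D ] ∣ Λ y ∣ ≡ k * k
      ∑∣Λ∣≡k*k = begin
        ∑[ y < _ ] ∣ Λ y ∣     ≡⟨ sum-cong-≗ (λ y → ∣∣-cong (Λ⊆Fᵀ y) (Fᵀ⊆Λ y)) ⟩
        ∑[ y < _ ] ∣ (F ᵀ) y ∣ ≡⟨ sym (∑∣∣ᵀ F) ⟩
        ∑[ u < _ ] ∣ F u ∣     ≡⟨ ∑-indicator ∣F∣≡k ∣F∣≡0 ⟩
        ∣ N⁻ x ∣ * k           ≡⟨ cong (_* k) (indeg x) ⟩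
        k * k                  ∎
        where
        open ≡-Reasoning
        F : Vertex → VSet
        F = N⁻ x ◃ N⁺
        Λ⊆Fᵀ : ∀ y → Λ y ⊆ (F ᵀ) y
        Λ⊆Fᵀ y u u∈ = ∈ᵀ⁺ (∈◃⁺ (∩⁻ u∈ .proj₁) (∈N⁻⇒⟶ (∩⁻ u∈ .proj₂)))
        Fᵀ⊆Λ : ∀ y → (F ᵀ) y ⊆ Λ y
        Fᵀ⊆Λ y u u∈ = let (u∈N⁻x , u⟶y) = ∈◃⁻ (∈ᵀ⁻ u∈) in ∩⁺ u∈N⁻x (⟶⇒∈N⁻ u⟶y)
        ∣F∣≡k : ∀ u → u ∈ N⁻ x → ∣ F u ∣ ≡ k
        ∣F∣≡k u u∈ = trans (∣∣-cong (λ _ y∈ → ∈◃⁻ y∈ .proj₂) (λ _ y∈ → ∈◃⁺ u∈ y∈)) (outdeg u)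
        ∣F∣≡0 : ∀ u → u ∉ N⁻ x → ∣ F u ∣ ≡ 0
        ∣F∣≡0 u u∉ = ∣∣-empty λ _ y∈ → ∉⇒¬∈ u∉ (∈◃⁻ y∈ .proj₁)

      ∑∣Λ∣[∣Λ∣∸1] : ∑[ y < size D ] (∣ Λ y ∣ * (∣ Λ y ∣ ∸ 1)) ≡ k * ((k ∸ 1) * α)
      ∑∣Λ∣[∣Λ∣∸1] = begin
        ∑[ y < _ ] (∣ Λ y ∣ * (∣ Λ y ∣ ∸ 1)) ≡⟨ sum-cong-≗ (λ y → sym (∑-indicator (∣H∣ y) (∣H∣≡0 y))) ⟩
        ∑[ y < _ ] ∑[ u < _ ] ∣ H y u ∣      ≡⟨ ∑-comm (λ y u → ∣ H y u ∣) ⟩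
        ∑[ u < _ ] ∑[ y < _ ] ∣ H y u ∣      ≡⟨ sum-cong-≗ (λ u → ∑∣∣ᵀ (λ y → H y u)) ⟩
        ∑[ u < _ ] ∑[ u′ < _ ] ∣ Hᵀ u u′ ∣   ≡⟨ ∑-indicator row row≡0 ⟩
        ∣ N⁻ x ∣ * ((k ∸ 1) * α)             ≡⟨ cong (_* ((k ∸ 1) * α)) (indeg x) ⟩
        k * ((k ∸ 1) * α)                    ∎
        where
        open ≡-Reasoning
        H : Vertex → Vertex → VSet
        H y = Λ y ◃ λ u → Λ y - u
        Hᵀ : Vertex → Vertex → VSet
        Hᵀ u = (λ y → H y u) ᵀ
        ∣H∣ : ∀ y u → u ∈ Λ y → ∣ H y u ∣ ≡ ∣ Λ y ∣ ∸ 1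
        ∣H∣ y u u∈ = trans (∣∣-cong (λ _ h → ∈◃⁻ h .proj₂) (λ _ h → ∈◃⁺ u∈ h))
                            (cong (_∸ 1) (sym (∣P∣≡1+∣P-x∣ u∈)))
        ∣H∣≡0 : ∀ y u → u ∉ Λ y → ∣ H y u ∣ ≡ 0
        ∣H∣≡0 y u u∉ = ∣∣-empty λ _ h → ∉⇒¬∈ u∉ (∈◃⁻ h .proj₁)
        ∣Hᵀ∣ : ∀ u → u ∈ N⁻ x → ∀ u′ → u′ ∈ N⁻ x - u → ∣ Hᵀ u u′ ∣ ≡ α
        ∣Hᵀ∣ u u∈ u′ u′∈ = trans (∣∣-cong Hᵀ⊆ ⊆Hᵀ) (∣N⁺∩N⁺∣≡ liking₂ (-⁻ u′∈ .proj₂ ∘ sym))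
          where
          Hᵀ⊆ : Hᵀ u u′ ⊆ N⁺ u ∩ N⁺ u′
          Hᵀ⊆ y y∈ = let (u∈Λ , u′∈Λ-u) = ∈◃⁻ (∈ᵀ⁻ y∈) in
            ∩⁺ (∈N⁻⇒⟶ (∩⁻ u∈Λ .proj₂)) (∈N⁻⇒⟶ (∩⁻ (-⁻ u′∈Λ-u .proj₁) .proj₂))
          ⊆Hᵀ : N⁺ u ∩ N⁺ u′ ⊆ Hᵀ u u′
          ⊆Hᵀ y y∈ = ∈ᵀ⁺ (∈◃⁺ (∩⁺ u∈ (⟶⇒∈N⁻ (∩⁻ y∈ .proj₁)))
                              (-⁺ (∩⁺ (-⁻ u′∈ .proj₁) (⟶⇒∈N⁻ (∩⁻ y∈ .proj₂))) (-⁻ u′∈ .proj₂)))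
        ∣Hᵀ∣≡0 : ∀ u u′ → u′ ∉ N⁻ x - u → ∣ Hᵀ u u′ ∣ ≡ 0
        ∣Hᵀ∣≡0 u u′ u′∉ = ∣∣-empty λ y y∈ → let u′∈Λ-u = ∈◃⁻ (∈ᵀ⁻ y∈) .proj₂ in
          ∉⇒¬∈ u′∉ (-⁺ (∩⁻ (-⁻ u′∈Λ-u .proj₁) .proj₁) (-⁻ u′∈Λ-u .proj₂))
        row : ∀ u → u ∈ N⁻ x → ∑[ u′ < _ ] ∣ Hᵀ u u′ ∣ ≡ (k ∸ 1) * α
        row u u∈ = trans (∑-indicator (∣Hᵀ∣ u u∈) (∣Hᵀ∣≡0 u))
                         (cong (λ m → (m ∸ 1) * α) (trans (sym (∣P∣≡1+∣P-x∣ u∈)) (indeg x)))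
        row≡0 : ∀ u → u ∉ N⁻ x → ∑[ u′ < _ ] ∣ Hᵀ u u′ ∣ ≡ 0
        row≡0 u u∉ = ∑-zero λ u′ → ∣∣-empty {P = Hᵀ u u′} λ y y∈ →
          ∉⇒¬∈ u∉ (∩⁻ (∈◃⁻ (∈ᵀ⁻ y∈) .proj₁) .proj₁)

      ∣Λx∣≡k : ∣ Λ x ∣ ≡ k
      ∣Λx∣≡k = trans (∣∣-cong (λ _ u∈ → ∩⁻ u∈ .proj₁) (λ _ u∈ → ∩⁺ u∈ u∈)) (indeg x)

      -- Variance argument: over y ≢ x, the first two moments of ∣ Λ y ∣ are those of the constant
      -- α, so AM–GM holds with equality at every y ≢ x; the δ-terms make F and G agree at y = x.
      common-in-neighbours : ∀ {y} → y ≢ x → ∣ Λ y ∣ ≡ α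
      common-in-neighbours {y} y≢x = 2ax≡x²+a²⇒x≡a (F≡G⇒ (sum-squeeze F≤G (≤-reflexive ∑G≡∑F) y))
        where
        open ≡-Reasoning
        a : Vertex → ℕ
        a y = ∣ Λ y ∣
        F G : Vertex → ℕ
        F y = 2 * α * a y + δ x y * (a y * a y + α * α)
        G y = a y * a y + α * α + δ x y * (2 * α * a y)
        F≤G : ∀ y → F y ≤ G y
        F≤G y with y ≟ x
        ... | yes refl rewrite δ-diag x = ≤-reflexive (swap (2 * α * a x) (a x * a x + α * α))
          where
          swap : ∀ p q → p + 1 * q ≡ q + 1 * p
          swap = solve-∀
        ... | no  y≢x  rewrite δ-off y≢x = +-monoˡ-≤ 0 (2ax≤x²+a² (a y) α)
        F≡G⇒ : F y ≡ G y → 2 * α * a y ≡ a y * a y + α * α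
        F≡G⇒ F≡G rewrite δ-off y≢x = trans (sym (+-identityʳ _)) (trans F≡G (+-identityʳ _))
        N = size D
        ∑G≡∑F : ∑[ y < N ] G y ≡ ∑[ y < N ] F y
        ∑G≡∑F = begin
          ∑[ y < N ] G y
            ≡⟨ ∑-distrib-+ (λ y → a y * a y + α * α) (λ y → δ x y * (2 * α * a y)) ⟩
          ∑[ y < N ] (a y * a y + α * α) + ∑[ y < N ] (δ x y * (2 * α * a y))
            ≡⟨ cong₂ _+_ (∑-distrib-+ (λ y → a y * a y) (λ _ → α * α)) (∑-δ x (λ y → 2 * α * a y)) ⟩
          ∑[ y < N ] (a y * a y) + ∑[ y < N ] (α * α) + 2 * α * a x
            ≡⟨ cong₂ (λ s t → s + t + 2 * α * a x) (trans (sum-cong-≗ (m*m≡m*[m∸1]+m ∘ a))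
                                                            (∑-distrib-+ (λ y → a y * (a y ∸ 1)) a))
                                                     (∑-const {N} (α * α)) ⟩
          ∑[ y < N ] (a y * (a y ∸ 1)) + ∑[ y < N ] a y + N * (α * α) + 2 * α * a x
            ≡⟨ cong₂ (λ s t → s + t + N * (α * α) + 2 * α * a x) ∑∣Λ∣[∣Λ∣∸1] ∑∣Λ∣≡k*k ⟩
          k * ((k ∸ 1) * α) + k * k + N * (α * α) + 2 * α * a x
            ≡⟨ cong (λ z → k * ((k ∸ 1) * α) + k * k + N * (α * α) + 2 * α * z) ∣Λx∣≡k ⟩
          k * ((k ∸ 1) * α) + k * k + N * (α * α) + 2 * α * k
            ≡⟨ variance-identity k N α 1≤k 1≤N k[k-1]≡[n-1]α ⟩
          2 * α * (k * k) + (k * k + α * α)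
            ≡⟨ cong₂ (λ s t → 2 * α * s + (t * t + α * α)) (sym ∑∣Λ∣≡k*k) (sym ∣Λx∣≡k) ⟩
          2 * α * ∑[ y < N ] a y + (a x * a x + α * α)
            ≡⟨ cong₂ _+_ (*-distribˡ-sum (2 * α) a) (sym (∑-δ x (λ y → a y * a y + α * α))) ⟩
          ∑[ y < N ] (2 * α * a y) + ∑[ y < N ] (δ x y * (a y * a y + α * α))
            ≡⟨ sym (∑-distrib-+ (λ y → 2 * α * a y) (λ y → δ x y * (a y * a y + α * α))) ⟩
          ∑[ y < N ] F y ∎
          where
          1≤N : 1 ≤ N
          1≤N = ≤-trans (s≤s z≤n) (≤-reflexive (trans (sym (∣P∣≡1+∣P-x∣ {x = x} {P = full} x∈full)) (∣full∣≡n {N})))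

    α<k : ∀ {α} → LikingOn full 2 α → 1 ≤ k → Vertex → α < k
    α<k {α} liking₂ 1≤k x with ∃∈ (≤-trans 1≤k (≤-reflexive (sym (outdeg x))))
    ... | y , x⟶y = begin
      suc α                      ≡⟨ cong suc (sym (∣N⁺∩N⁺∣≡ liking₂ (⟶-irrefl x⟶y))) ⟩
      suc ∣ N⁺ x ∩ N⁺ y ∣        ≤⟨ s≤s (∣∣-mono λ z z∈ → -⁺ (∩⁻ z∈ .proj₁) (⟶-irrefl (∩⁻ z∈ .proj₂) ∘ sym)) ⟩
      suc ∣ N⁺ x - y ∣           ≡⟨ sym (∣P∣≡1+∣P-x∣ x⟶y) ⟩
      ∣ N⁺ x ∣                   ≡⟨ outdeg x ⟩
      k                          ∎
      where open ≤-Reasoning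

    [α-1][α-2]≡[k-2][β-1] : ∀ {α β} → LikingOn full 3 β → LikingOn full 2 α → 3 ≤ k →
      k * (k ∸ 1) ≡ (size D ∸ 1) * α → Vertex → (α ∸ 1) * (α ∸ 2) ≡ (k ∸ 2) * (β ∸ 1)
    [α-1][α-2]≡[k-2][β-1] {α} {β} liking₃ liking₂ 3≤k k[k-1]≡[n-1]α x
      with ∃₂∈ (≤-trans (n≤1+n 2) (≤-trans 3≤k (≤-reflexive (sym (indeg x)))))
    ... | u , u′ , u∈ , u′∈ , u≢u′ = begin
      (α ∸ 1) * (α ∸ 2)                    ≡⟨ cong (_* (α ∸ 2)) (sym (∣common⁺∣-x liking₂ U⊆N⁻x ∣U∣)) ⟩
      ∣ common⁺ U ∩ (full - x) ∣ * (α ∸ 2) ≡⟨ ∣common⁺∣-double-count (λ S → ∣common⁺∣-x liking₃)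
                                                                   common-in U⊆N⁻x ∣U∣ ⟩
      (∣ N⁻ x ∣ ∸ 2) * (β ∸ 1)             ≡⟨ cong (λ m → (m ∸ 2) * (β ∸ 1)) (indeg x) ⟩
      (k ∸ 2) * (β ∸ 1)                    ∎
      where
      open ≡-Reasoning
      U = ｛ u ｝ ∪ ｛ u′ ｝
      U⊆N⁻x : U ⊆ N⁻ x
      U⊆N⁻x = ｛x｝∪｛y｝⊆ u∈ u′∈
      ∣U∣ = ∣｛x｝∪｛y｝∣≡2 u≢u′
      ∣common⁺∣-x : ∀ {s μ S} → LikingOn full s μ → S ⊆ N⁻ x → ∣ S ∣ ≡ s →
                    ∣ common⁺ S ∩ (full - x) ∣ ≡ μ ∸ 1
      ∣common⁺∣-x liking S⊆N⁻x ∣S∣ = ∣common⁺∩full-x∣ (common⁺⁺ λ v v∈ → ∈N⁻⇒⟶ (S⊆N⁻x v v∈))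
                                                   (∣common⁺∣-full liking ∣S∣)
      common-in : ∀ c → c ∈ full - x → ∣ N⁻ c ∩ N⁻ x ∣ ≡ α
      common-in c c∈ = trans (∣P∩Q∣≡∣Q∩P∣ (N⁻ c) (N⁻ x))
        (CommonInNeighbours.common-in-neighbours liking₂ (≤-trans (s≤s z≤n) 3≤k) k[k-1]≡[n-1]α x (-⁻ c∈ .proj₂))

    size≡1+k⇒Complete : size D ≡ suc k → Complete
    size≡1+k⇒Complete n≡1+k {u} {w} _ _ u≢w =
      ⊆∧∣∣≥⇒⊇ N⁺u⊆full-u (≤-reflexive (trans (∣full-v∣ u) (trans (cong (_∸ 1) n≡1+k) (sym (outdeg u)))))
                w (-⁺ x∈full (u≢w ∘ sym))
      where
      N⁺u⊆full-u : N⁺ u ⊆ full - u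
      N⁺u⊆full-u z u⟶z = -⁺ x∈full (⟶-irrefl u⟶z ∘ sym)

    completeOn : ∀ j {μ} → LikingOn full (3 + j) μ → 1 ≤ μ → 3 + j ≤ size D → Complete
    completeOn j liking 1≤μ t≤n = size≡1+k⇒Complete (from-β (liking-descends-to-3 indeg j liking 1≤μ t≤n))
      where
      3≤n = ≤-trans (m≤m+n 3 j) t≤n
      2≤n = ≤-trans (n≤1+n 2) 3≤n
      x₀ : Vertex
      x₀ = ∃∈ {P = full} (≤-trans (s≤s z≤n) (≤-trans 3≤n (≤-reflexive (sym ∣full∣≡n)))) .proj₁
      from-β : ∃[ β ] LikingOn full 3 β × 1 ≤ β → size D ≡ suc k
      from-β (β , liking₃ , 1≤β) = from-α (liking-descends indeg liking₃ 1≤β 3≤n)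
        where
        from-α : ∃[ α ] LikingOn full 2 α × α * (k ∸ 2) ≡ (size D ∸ 2) * β × 1 ≤ α × 3 ≤ k → size D ≡ suc k
        from-α (α , liking₂ , α[k-2]≡[n-2]β , 1≤α , 3≤k) =
          diregular-parameters 1≤α (α<k liking₂ 1≤k x₀) 2≤n 1≤β k[k-1]≡[n-1]α α[k-2]≡[n-2]β
                               ([α-1][α-2]≡[k-2][β-1] liking₃ liking₂ 3≤k k[k-1]≡[n-1]α x₀)
          where
          1≤k = ≤-trans (s≤s z≤n) 3≤k
          k[k-1]≡[n-1]α : k * (k ∸ 1) ≡ (size D ∸ 1) * α
          k[k-1]≡[n-1]α with liking-descends indeg liking₂ 1≤α 2≤n
          ... | α₁ , liking₁ , α₁[k-1]≡[n-1]α , _ = subst (λ m → m * (k ∸ 1) ≡ (size D ∸ 1) * α) α₁≡k α₁[k-1]≡[n-1]α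
            where
            α₁≡k : α₁ ≡ k
            α₁≡k = begin
              α₁                    ≡⟨ sym (LikingOn-1⇒outdeg liking₁ x∈full) ⟩
              ∣ N⁺ x₀ ∩ full ∣      ≡⟨ ∣P∩full∣ (N⁺ x₀) ⟩
              ∣ N⁺ x₀ ∣             ≡⟨ outdeg x₀ ⟩
              k                     ∎
              where open ≡-Reasoning

  Diregular⇒Complete : ∀ {t μ} → LikingOn full t μ → 1 ≤ μ → 3 ≤ t → t ≤ size D → Diregular D → Complete
  Diregular⇒Complete {suc (suc (suc j))} liking 1≤μ (s≤s (s≤s (s≤s _))) t≤n (k , _ , degrees) =
    Diregular.completeOn (λ v → trans (sym (outdeg≡∣N⁺∣ v)) (degrees v .proj₁))
                         (λ v → trans (sym (indeg≡∣N⁻∣ v)) (degrees v .proj₂)) j liking 1≤μ t≤n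

module Characterisation (a b : ℕ) (D : Digraph) (liking : Liking (2 + a) (1 + b) D) where

  likingᶠ : LikingOn D full (2 + a) (1 + b)
  likingᶠ = Liking⇒LikingOn D liking

  t≤n : 2 + a ≤ size D
  t≤n = liking .proj₁

  t≤∣full∣ : 2 + a ≤ ∣ full {size D} ∣
  t≤∣full∣ = ≤-trans t≤n (≤-reflexive (sym ∣full∣≡n))

  n≡t+l : Complete D → size D ≡ 2 + a + (1 + b)
  n≡t+l complete′ = Complete⇒size D complete′ (s≤s z≤n) t≤n likingᶠ

  Complete⇔Isomorphic : Complete D ⇔ Isomorphic D (complete (2 + a + (1 + b)))
  Complete⇔Isomorphic = mk⇔ to from
    where
    to : Complete D → Isomorphic D (complete (2 + a + (1 + b)))
    to complete′ = Complete⇒Isomorphic D complete′ (n≡t+l complete′)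
    from : Isomorphic D (complete (2 + a + (1 + b))) → Complete D
    from iso = Isomorphic⇒Complete D iso .proj₁

  Complete⇔Liking⁻ : Complete D ⇔ Liking (1 + a) (1 + b + 1) D
  Complete⇔Liking⁻ = mk⇔ to from
    where
    to : Complete D → Liking (1 + a) (1 + b + 1) D
    to complete′ = LikingOn⇒Liking D (≤-trans (n≤1+n _) t≤n)
      (subst (LikingOn D full (1 + a)) n-[1+a]≡2+b (Complete⇒LikingOn D complete′ (s≤s z≤n)))
      where
      n-[1+a]≡2+b : size D ∸ (1 + a) ≡ 1 + b + 1
      n-[1+a]≡2+b = begin
        size D ∸ (1 + a)              ≡⟨ cong (_∸ (1 + a)) (n≡t+l complete′) ⟩
        2 + a + (1 + b) ∸ (1 + a)     ≡⟨ cong (λ m → suc m ∸ (1 + a)) (sym (+-suc a (suc b))) ⟩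
        (1 + a) + (2 + b) ∸ (1 + a)   ≡⟨ m+n∸m≡n (1 + a) (2 + b) ⟩
        2 + b                         ≡⟨ cong suc (+-comm 1 b) ⟩
        1 + b + 1                     ∎
        where open ≡-Reasoning
    from : Liking (1 + a) (1 + b + 1) D → Complete D
    from liking⁻ = LikingOn-pair⇒CompleteOn D likingᶠ
      (subst (LikingOn D full (1 + a)) (+-comm (1 + b) 1) (Liking⇒LikingOn D liking⁻))
      (s≤s z≤n) (≤-trans (n≤1+n _) t≤∣full∣) λ { (_ , ()) }

  Complete⇔OutRegular : Complete D ⇔ (∀ v → outdeg D v ≡ 2 + a + (1 + b) ∸ 1)
  Complete⇔OutRegular = mk⇔ to from
    where
    to : Complete D → ∀ v → outdeg D v ≡ 2 + a + (1 + b) ∸ 1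
    to complete′ v = trans (outdeg≡∣N⁺∣ D v)
      (trans (Complete⇒∣N⁺∣ D complete′ v) (cong (_∸ 1) (n≡t+l complete′)))
    from : (∀ v → outdeg D v ≡ 2 + a + (1 + b) ∸ 1) → Complete D
    from outdeg′ = OutRegular.completeOn D {a = a} {b = b} likingᶠ λ {x} _ →
      trans (∣P∩full∣ (N⁺ D x)) (trans (sym (outdeg≡∣N⁺∣ D x)) (trans (outdeg′ x) (cong suc (+-suc a b))))

  Complete⇔UniversalVertex : ¬ (2 + a ≡ 2 × 1 + b ≡ 1) →
    Complete D ⇔ Σ (Fin (size D)) (λ v → outNbr D v ≡ ∁ ⁅ v ⁆)
  Complete⇔UniversalVertex excluded = mk⇔ to from
    where
    to : Complete D → Σ (Fin (size D)) (λ v → outNbr D v ≡ ∁ ⁅ v ⁆)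
    to complete′ = v₀ , Equivalence.from (outNbr≡∁⁅v⁆⇔ D v₀) (λ w≢v → complete′ x∈full x∈full (w≢v ∘ sym))
      where
      v₀ = ∃∈ {P = full} (≤-trans (s≤s z≤n) t≤∣full∣) .proj₁
    from : Σ (Fin (size D)) (λ v → outNbr D v ≡ ∁ ⁅ v ⁆) → Complete D
    from (v , outNbr≡) = UniversalVertex.completeOn D (Equivalence.to (outNbr≡∁⁅v⁆⇔ D v) outNbr≡) likingᶠ
      (s≤s z≤n) t≤n λ (1+a≡1 , b≡0) → excluded (cong suc 1+a≡1 , cong suc b≡0)

  Complete⇔Diregular : 3 ≤ 2 + a → Complete D ⇔ Diregular D
  Complete⇔Diregular 3≤t = mk⇔ to (Diregular⇒Complete D likingᶠ (s≤s z≤n) 3≤t t≤n)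
    where
    to : Complete D → Diregular D
    to complete′ = size D ∸ 1 , ∸-monoˡ-≤ 1 (≤-trans (s≤s (s≤s z≤n)) t≤n) ,
      λ v → trans (outdeg≡∣N⁺∣ D v) (Complete⇒∣N⁺∣ D complete′ v) ,
            trans (indeg≡∣N⁻∣ D v) (Complete⇒∣N⁻∣ D complete′ v)

theorem1p2 : (t l : ℕ) → 2 ≤ t → 1 ≤ l → (D : Digraph) → Liking t l D →
    ((Isomorphic D (complete (t + l)) ⇔ Liking (t ∸ 1) (l + 1) D)
      × (Isomorphic D (complete (t + l)) ⇔ (∀ v → outdeg D v ≡ t + l ∸ 1)))
    × (¬ (t ≡ 2 × l ≡ 1) →
        (Isomorphic D (complete (t + l)) ⇔ Σ (Fin (size D)) (λ v → outNbr D v ≡ ∁ ⁅ v ⁆)))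
    × (3 ≤ t → (Isomorphic D (complete (t + l)) ⇔ Diregular D))
theorem1p2 (suc (suc a)) (suc b) (s≤s (s≤s z≤n)) (s≤s z≤n) D liking =
  (via Complete⇔Liking⁻ , via Complete⇔OutRegular) ,
  (λ excluded → via (Complete⇔UniversalVertex excluded)) ,
  (λ 3≤t → via (Complete⇔Diregular 3≤t))
  where
  open Characterisation a b D liking
  via : ∀ {X : Set} → Complete D ⇔ X → Isomorphic D (complete (suc (suc a) + suc b)) ⇔ X
  via = ⇔.trans (⇔.sym Complete⇔Isomorphic)
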